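{- Let $(V,E,F,H)$ be an instance of Constrained Correlation Clustering admitting a valid clustering, let $\mathrm{OPT}$ be the edge set of an optimal valid clustering, and let $E'$ be the edge set of $\textsc{Transform}(G,F,H)$. Then $|E\triangle E'|\le(1+\sqrt5)\,|E\triangle\mathrm{OPT}|$.
   Context: A clustering of $V$ is a partition; its edge set is the set of pairs inside a common part. Instance: graph $G=(V,E)$, friendly pairs $F$, hostile pairs $H\subseteq\binom V2$; a clustering is valid if no pair of $F$ is split and no pair of $H$ shares a cluster; the cost is $|E\triangle E_C|$. Supernodes are the connected components of $(V,F)$; $s(u)$ is the supernode of $u$; supernodes $U,W$ are hostile if some $uw\in H$ has $u\in U,w\in W$. $\textsc{Transform}(G,F,H)$: if some supernode is hostile to itself, return $(\emptyset,\emptyset)$. Otherwise let $E_1=E\cup\{uv: s(u)=s(v)\}$; $E_2=E_1\setminus\{uv: s(u),s(v)\text{ hostile}\}$; $E_3\gets E_2$ and, while there exist three distinct supernodes $U_1,U_2,U_3$ with $U_1,U_2$ hostile and $u_1\in U_1,u_2\in U_2,u_3,u_3'\in U_3$ with $u_1u_3,u_2u_3'\in E_3$, remove $u_1u_3$ and $u_2u_3'$ from $E_3$; $E_4\gets E_3$ and for each unordered pair of distinct supernodes $\{U_1,U_2\}$, with $E_{U_1,U_2}=\{u_1u_2:u_1\in U_1,u_2\in U_2\}$, if $|E_{U_1,U_2}\cap E_4|>\frac{3-\sqrt5}{2}|U_1||U_2|$ set $E_4\gets E_4\cup E_{U_1,U_2}$, else $E_4\gets E_4\setminus E_{U_1,U_2}$.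 Return $(V,E_4)$. -}

module Defs where

open import Data.Nat using (ℕ; _+_; _*_; _∸_; _^_; _≤_; _<ᵇ_)
open import Data.Bool using (Bool; true; false; T; not; _∧_; _∨_; _xor_; if_then_else_)
open import Data.Fin using (Fin; _≟_; _<?_)
open import Data.List using (List; map; allFin)
open import Data.Nat.ListAction using (sum)
open import Data.Bool.ListAction using (any)
open import Data.Product using (_×_)
open import Data.Empty using (⊥)
open import Function.Bundles using (_⇔_)
open import Relation.Binary.PropositionalEquality using (_≡_; _≢_)
open import Relation.Nullary.Decidable using (⌊_⌋)
open import Relation.Binary.Construct.Closure.ReflexiveTransitive using (Star)

-- A set of unordered pairs of distinct vertices (a subset of binom V 2) is
-- represented by a Boolean matrix P; the pair {i,j} belongs to it iff
-- i ≢ j and (P i j or P j i).  Every subset of binom V 2 is representable.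
PairMat : ℕ → Set
PairMat n = Fin n → Fin n → Bool

_≠ᵇ_ : ∀ {n} → Fin n → Fin n → Bool
i ≠ᵇ j = not ⌊ i ≟ j ⌋

_==ᵇ_ : ∀ {n} → Fin n → Fin n → Bool
i ==ᵇ j = ⌊ i ≟ j ⌋

⟦_⟧ : ∀ {n} → PairMat n → Fin n → Fin n → Bool
⟦ P ⟧ i j = (i ≠ᵇ j) ∧ (P i j ∨ P j i)

pairCount : ∀ {n} → PairMat n → ℕ
pairCount {n} P =
  sum (map (λ i → sum (map (λ j → if ⌊ i <? j ⌋ ∧ ⟦ P ⟧ i j then 1 else 0) (allFin n))) (allFin n))

symDiff : ∀ {n} → PairMat n → PairMat n → ℕ
symDiff A B = pairCount (λ i j → ⟦ A ⟧ i j xor ⟦ B ⟧ i j)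

-- A clustering (partition of V) is given by a cluster label for each vertex;
-- its edge set consists of the pairs in a common cluster.
Clustering : ℕ → Set
Clustering n = Fin n → Fin n

clusterEdges : ∀ {n} → Clustering n → PairMat n
clusterEdges c i j = c i ==ᵇ c j

Valid : ∀ {n} → PairMat n → PairMat n → Clustering n → Set
Valid F H c =
  (∀ i j → T (⟦ F ⟧ i j) → c i ≡ c j) × (∀ i j → T (⟦ H ⟧ i j) → c i ≢ c j)

OptimalValid : ∀ {n} → PairMat n → PairMat n → PairMat n → Clustering n → Set
OptimalValid E F H c =
  Valid F H c × (∀ c' → Valid F H c' → symDiff E (clusterEdges c) ≤ symDiff E (clusterEdges c'))

-- Supernodes: connected components of (V,F).  s is a labelling of vertices
-- whose fibres are exactly these components: s u ≡ s v iff u,v connected in (V,F).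
IsSupernodeLabelling : ∀ {n} → PairMat n → (Fin n → Fin n) → Set
IsSupernodeLabelling {n} F s =
  ∀ (u v : Fin n) → (s u ≡ s v) ⇔ Star (λ a b → T (⟦ F ⟧ a b)) u v

hostile : ∀ {n} → (Fin n → Fin n) → PairMat n → Fin n → Fin n → Bool
hostile {n} s H U W =
  any (λ a → any (λ b → (s a ==ᵇ U) ∧ ((s b ==ᵇ W) ∧ ⟦ H ⟧ a b)) (allFin n)) (allFin n)

E₁ : ∀ {n} → (Fin n → Fin n) → PairMat n → PairMat n
E₁ s E u v = ⟦ E ⟧ u v ∨ ((u ≠ᵇ v) ∧ (s u ==ᵇ s v))

E₂ : ∀ {n} → (Fin n → Fin n) → PairMat n → PairMat n → PairMat n
E₂ s E H u v = E₁ s E u v ∧ not (hostile s H (s u) (s v))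

removePair : ∀ {n} → Fin n → Fin n → PairMat n → PairMat n
removePair a b P i j =
  if ((i ==ᵇ a) ∧ (j ==ᵇ b)) ∨ ((i ==ᵇ b) ∧ (j ==ᵇ a)) then false else P i j

-- one iteration of the while loop of step 3
data Step {n} (s : Fin n → Fin n) (H : PairMat n) (P : PairMat n) : PairMat n → Set where
  step : (u₁ u₂ u₃ u₃' : Fin n) →
         s u₁ ≢ s u₂ → s u₁ ≢ s u₃ → s u₂ ≢ s u₃ →
         T (hostile s H (s u₁) (s u₂)) →
         s u₃' ≡ s u₃ →
         T (⟦ P ⟧ u₁ u₃) → T (⟦ P ⟧ u₂ u₃') →
         Step s H P (removePair u₂ u₃' (removePair u₁ u₃ P))

Terminal : ∀ {n} → (Fin n → Fin n) → PairMat n → PairMat n → Set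
Terminal {n} s H P =
  (u₁ u₂ u₃ u₃' : Fin n) →
  s u₁ ≢ s u₂ → s u₁ ≢ s u₃ → s u₂ ≢ s u₃ →
  T (hostile s H (s u₁) (s u₂)) →
  s u₃' ≡ s u₃ →
  T (⟦ P ⟧ u₁ u₃) → T (⟦ P ⟧ u₂ u₃') → ⊥

-- k > ((3 - √5)/2) * m, decided exactly over ℕ:
-- 2k > 3m - √5 m  ⟺  3m < 2k  or  (3m - 2k)² < 5 m²
exceedsThreshold : ℕ → ℕ → Bool
exceedsThreshold k m = ((3 * m) <ᵇ (2 * k)) ∨ ((((3 * m) ∸ (2 * k)) ^ 2) <ᵇ (5 * (m ^ 2)))

-- |E_{U,W} ∩ P| (U ≠ W, so ordered pairs (a,b), a ∈ U, b ∈ W, count each pair once)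
crossCount : ∀ {n} → (Fin n → Fin n) → PairMat n → Fin n → Fin n → ℕ
crossCount {n} s P U W =
  sum (map (λ a → sum (map (λ b → if (s a ==ᵇ U) ∧ ((s b ==ᵇ W) ∧ ⟦ P ⟧ a b) then 1 else 0) (allFin n))) (allFin n))

crossSize : ∀ {n} → (Fin n → Fin n) → Fin n → Fin n → ℕ
crossSize {n} s U W =
  sum (map (λ a → sum (map (λ b → if (s a ==ᵇ U) ∧ (s b ==ᵇ W) then 1 else 0) (allFin n))) (allFin n))

-- step 4: E₄ from E₃ (the per-pair decisions are independent, each using the
-- count in E₃ since modifying other supernode pairs does not affect E_{U,W})
E₄ : ∀ {n} → (Fin n → Fin n) → PairMat n → PairMat n
E₄ s P u v =
  if s u ==ᵇ s v then ⟦ P ⟧ u v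
  else exceedsThreshold (crossCount s P (s u) (s v)) (crossSize s (s u) (s v))

-- a ≤ (1 + √5) b  over ℕ  ⟺  (a ∸ b)² ≤ 5 b²
≤OnePlusSqrt5* : ℕ → ℕ → Set
≤OnePlusSqrt5* a b = ((a ∸ b) ^ 2) ≤ 5 * (b ^ 2)

-- Split the pairs of vertices into blocks E_{U,W} between supernodes U, W.  Inside a
-- supernode, E₄ and OPT both contain every pair.  For U ≠ W let m = |U||W| and k the
-- number of pairs of the block surviving step 3; step 4 keeps the whole block iff
-- k > τm with τ = (3 - √5)/2, and τ is chosen so that m ≤ √5 (m - k) when the block is
-- dropped and m - k ≤ √5 k when it is kept.  This bounds the cost of E₄ on each block
-- by the cost of OPT plus √5 times a share of it, except for the pairs removed in
-- step 3, which are paid for by a charging argument: an iteration removes a pair from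
-- each of two blocks (U₁,U₃), (U₂,U₃) with U₁, U₂ hostile, so OPT separates at least
-- one of them, and as the loop has terminated one of them is empty in E₃.
-- Symmetric differences are counted over ordered pairs, i.e. doubled, and
-- x ≤ y + √5 z is expressed as (x - y)² ≤ 5 z².

module Submission where

open import Data.Nat using (ℕ; zero; suc; _+_; _*_; _∸_; _^_; _≤_; _<_; z≤n; _<ᵇ_; _≡ᵇ_; _≤?_)
import Data.Nat as ℕ
open import Data.Nat.Properties hiding (_≟_; _<?_; <-cmp; <-asym; suc-injective)
import Data.Nat.ListAction as List
open import Data.Nat.Tactic.RingSolver using (solve-∀)
open import Algebra.Properties.CommutativeMonoid.Sum +-0-commutativeMonoid
  using (sum-syntax; ∑-comm; ∑-distrib-+; sum-cong-≗; sum-replicate-zero)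
open import Data.Bool using (Bool; true; false; T; not; _∧_; _∨_; _xor_; if_then_else_)
open import Data.Bool.ListAction using (any)
open import Data.Bool.Properties
  using (∧-identityʳ; ∧-zeroʳ; ∧-idem; ∧-inverseʳ; ∨-identityʳ; ∨-zeroʳ; ∨-idem; ∨-abs-∧; ∨-comm; xor-identityʳ; xor-comm; T-≡; T-∧; T-∨)
open import Data.Empty using (⊥-elim)
open import Data.Fin using (Fin; zero; suc; _≟_; _<?_)
open import Data.Fin.Properties using (suc-injective; <-cmp; <-asym)
open import Data.List using (allFin; map; tabulate)
open import Data.List.Membership.Propositional using (lose)
open import Data.List.Membership.Propositional.Properties using (∈-allFin)
open import Data.List.Properties using (map-tabulate)
open import Data.List.Relation.Unary.Any using (satisfied)
open import Data.List.Relation.Unary.Any.Properties using (any⁺; any⁻)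
open import Data.Product using (∃; ∃₂; _×_; _,_; proj₁; proj₂)
import Data.Sum as Sum
open import Function using (_∘_; id)
open import Function.Bundles using (Equivalence; mk⇔)
open import Relation.Binary using (tri<; tri≈; tri>)
open import Relation.Binary.Construct.Closure.ReflexiveTransitive using (Star; ε; _◅_)
open import Relation.Binary.PropositionalEquality hiding (J)
open import Relation.Nullary using (yes; no; contradiction)
open import Relation.Nullary.Decidable using (⌊_⌋; isYes≗does; dec-true; dec-false; does-⇔; toWitness)
open import Defs

private
  variable
    n : ℕ

-- Inequalities x ≤ y + √5 z over ℕ

infix 4 _≤√5·_ _≤_+√5·_

_≤√5·_ : ℕ → ℕ → Set
d ≤√5· z = d * d ≤ 5 * (z * z)

-- A record, so that x, y and z can be inferred from a proof.
record _≤_+√5·_ (x y z : ℕ) : Set where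
  constructor mk
  field bound : x ∸ y ≤√5· z

^2≡* : ∀ x → x ^ 2 ≡ x * x
^2≡* x = cong (x *_) (*-identityʳ x)

*-self-cancel-≤ : ∀ {a b} → a * a ≤ b * b → a ≤ b
*-self-cancel-≤ {a} {b} p with a ≤? b
... | yes a≤b = a≤b
... | no a≰b = ⊥-elim (<⇒≱ (*-mono-< (≰⇒> a≰b) (≰⇒> a≰b)) p)

*-self-cancel-< : ∀ {a b} → a * a < b * b → a < b
*-self-cancel-< {a} {b} p = ≰⇒> (λ b≤a → <⇒≱ p (*-mono-≤ b≤a b≤a))

≤√5·-mono : ∀ {d d' z z'} → d' ≤ d → z ≤ z' → d ≤√5· z → d' ≤√5· z'
≤√5·-mono d'≤d z≤z' p = ≤-trans (*-mono-≤ d'≤d d'≤d) (≤-trans p (*-monoʳ-≤ 5 (*-mono-≤ z≤z' z≤z')))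

≤√5·-refl : ∀ z → z ≤√5· z
≤√5·-refl z = m≤n*m (z * z) 5

-- The cross term: (d₁d₂)² ≤ (5z₁z₂)², so d₁d₂ ≤ 5z₁z₂.
≤√5·-+ : ∀ {d₁ d₂ z₁ z₂} → d₁ ≤√5· z₁ → d₂ ≤√5· z₂ → d₁ + d₂ ≤√5· z₁ + z₂
≤√5·-+ {d₁} {d₂} {z₁} {z₂} p₁ p₂ = begin
  (d₁ + d₂) * (d₁ + d₂)                                 ≡⟨ square-+ d₁ d₂ ⟩
  d₁ * d₁ + 2 * (d₁ * d₂) + d₂ * d₂                     ≤⟨ +-mono-≤ (+-mono-≤ p₁ (*-monoʳ-≤ 2 cross)) p₂ ⟩
  5 * (z₁ * z₁) + 2 * (5 * (z₁ * z₂)) + 5 * (z₂ * z₂)  ≡⟨ five-square-+ z₁ z₂ ⟩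
  5 * ((z₁ + z₂) * (z₁ + z₂))                           ∎
  where
  open ≤-Reasoning
  square-+ : ∀ a b → (a + b) * (a + b) ≡ a * a + 2 * (a * b) + b * b
  square-+ = solve-∀
  five-square-+ : ∀ a b → 5 * (a * a) + 2 * (5 * (a * b)) + 5 * (b * b) ≡ 5 * ((a + b) * (a + b))
  five-square-+ = solve-∀
  square-* : ∀ a b → (a * b) * (a * b) ≡ (a * a) * (b * b)
  square-* = solve-∀
  five-square-* : ∀ a b → (5 * (a * a)) * (5 * (b * b)) ≡ (5 * (a * b)) * (5 * (a * b))
  five-square-* = solve-∀
  cross : d₁ * d₂ ≤ 5 * (z₁ * z₂)
  cross = *-self-cancel-≤ (begin
    (d₁ * d₂) * (d₁ * d₂)              ≡⟨ square-* d₁ d₂ ⟩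
    (d₁ * d₁) * (d₂ * d₂)              ≤⟨ *-mono-≤ p₁ p₂ ⟩
    (5 * (z₁ * z₁)) * (5 * (z₂ * z₂))  ≡⟨ five-square-* z₁ z₂ ⟩
    (5 * (z₁ * z₂)) * (5 * (z₁ * z₂))  ∎)

≤⇒≤+√5· : ∀ {x y z} → x ≤ y → x ≤ y +√5· z
≤⇒≤+√5· {z = z} x≤y = mk (subst (_≤√5· z) (sym (m≤n⇒m∸n≡0 x≤y)) z≤n)

≤+√5·-mono : ∀ {x y z x' y' z'} → x' ≤ x → y ≤ y' → z ≤ z' → x ≤ y +√5· z → x' ≤ y' +√5· z'
≤+√5·-mono {x} {y} {z} x'≤x y≤y' z≤z' (mk p) = mk (≤√5·-mono {x ∸ y} {_} {z} (∸-mono x'≤x y≤y') z≤z' p)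

≤+√5·-+ : ∀ {x₁ y₁ z₁ x₂ y₂ z₂} → x₁ ≤ y₁ +√5· z₁ → x₂ ≤ y₂ +√5· z₂ →
          x₁ + x₂ ≤ y₁ + y₂ +√5· (z₁ + z₂)
≤+√5·-+ {x₁} {y₁} {z₁} {x₂} {y₂} {z₂} (mk p₁) (mk p₂) =
  mk (≤√5·-mono {z = z₁ + z₂} difference-+ ≤-refl (≤√5·-+ {x₁ ∸ y₁} {x₂ ∸ y₂} {z₁} {z₂} p₁ p₂))
  where
  difference-+ : x₁ + x₂ ∸ (y₁ + y₂) ≤ (x₁ ∸ y₁) + (x₂ ∸ y₂)
  difference-+ = m≤n+o⇒m∸n≤o (x₁ + x₂) (y₁ + y₂) (begin
    x₁ + x₂                                   ≤⟨ +-mono-≤ (m≤n+m∸n x₁ y₁) (m≤n+m∸n x₂ y₂) ⟩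
    (y₁ + (x₁ ∸ y₁)) + (y₂ + (x₂ ∸ y₂))       ≡⟨ +-interchange y₁ _ y₂ _ ⟩
    (y₁ + y₂) + ((x₁ ∸ y₁) + (x₂ ∸ y₂))       ∎)
    where
    open ≤-Reasoning
    +-interchange : ∀ a b c d → (a + b) + (c + d) ≡ (a + c) + (b + d)
    +-interchange = solve-∀

≤+√5·-cancel : ∀ {x y z} a → x + a ≤ y + a +√5· z → x ≤ y +√5· z
≤+√5·-cancel {x} {y} {z} a (mk p) = mk (subst (_≤√5· z) (trans (cong₂ _∸_ (+-comm x a) (+-comm y a)) ([m+n]∸[m+o]≡n∸o a x y)) p)

≤+√5·-shift : ∀ {x y z} a → x ≤ y + a +√5· z → x ≤ y +√5· (z + a)
≤+√5·-shift {x} {y} {z} a (mk p) = mk (≤√5·-mono {z = z + a} difference-shift ≤-refl (≤√5·-+ {x ∸ (y + a)} {a} {z} {a} p (≤√5·-refl a)))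
  where
  difference-shift : x ∸ y ≤ (x ∸ (y + a)) + a
  difference-shift = m≤n+o⇒m∸n≤o x y (begin
    x                        ≤⟨ m≤n+m∸n x (y + a) ⟩
    y + a + (x ∸ (y + a))    ≡⟨ +-assoc y a _ ⟩
    y + (a + (x ∸ (y + a)))  ≡⟨ cong (y +_) (+-comm a _) ⟩
    y + ((x ∸ (y + a)) + a)  ∎)
    where open ≤-Reasoning

≤+√5·⇒≤OnePlusSqrt5* : ∀ {a b} → 2 * a ≤ 2 * b +√5· (2 * b) → ≤OnePlusSqrt5* a b
≤+√5·⇒≤OnePlusSqrt5* {a} {b} (mk p) = *-cancelˡ-≤ 4 (begin
  4 * (a ∸ b) ^ 2                       ≡⟨ cong (4 *_) (^2≡* (a ∸ b)) ⟩
  4 * ((a ∸ b) * (a ∸ b))               ≡⟨ four-square (a ∸ b) ⟩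
  (2 * (a ∸ b)) * (2 * (a ∸ b))         ≡⟨ cong (λ t → t * t) (*-distribˡ-∸ 2 a b) ⟩
  (2 * a ∸ 2 * b) * (2 * a ∸ 2 * b)     ≤⟨ p ⟩
  5 * ((2 * b) * (2 * b))               ≡⟨ five-four-square b ⟩
  4 * (5 * (b * b))                     ≡⟨ cong (λ t → 4 * (5 * t)) (^2≡* b) ⟨
  4 * (5 * b ^ 2)                       ∎)
  where
  open ≤-Reasoning
  four-square : ∀ x → 4 * (x * x) ≡ (2 * x) * (2 * x)
  four-square = solve-∀
  five-four-square : ∀ x → 5 * ((2 * x) * (2 * x)) ≡ 4 * (5 * (x * x))
  five-four-square = solve-∀

four-square<five-square : ∀ a b → 5 * (a * a) < b * b → (2 * a) * (2 * a) < b * b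
four-square<five-square a b 5aa<bb = ≤-<-trans (≤-reflexive (double-square a)) (≤-<-trans (*-monoˡ-≤ (a * a) (n≤1+n 4)) 5aa<bb)
  where double-square : ∀ a → (2 * a) * (2 * a) ≡ 4 * (a * a)
        double-square = solve-∀

-- The golden-ratio inequalities behind the threshold (3 - √5)/2: for m = d + k
-- one has 3m - 2k = 3d + k.
√5-below : ∀ d k → 5 * ((d + k) * (d + k)) ≤ (3 * d + k) * (3 * d + k) → d + k ≤√5· d
√5-below d k h = ≮⇒≥ λ 5dd<mm → <⇒≱ (lt 5dd<mm) h
  where
  open ≤-Reasoning
  m = d + k
  lt : 5 * (d * d) < m * m → (3 * d + k) * (3 * d + k) < 5 * (m * m)
  lt 5dd<mm = begin-strict
    (3 * d + k) * (3 * d + k)                      ≡⟨ expand d k ⟩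
    m * m + 2 * (m * (2 * d)) + (2 * d) * (2 * d)  <⟨ +-monoʳ-< _ 4dd<mm ⟩
    m * m + 2 * (m * (2 * d)) + m * m              ≤⟨ +-monoˡ-≤ (m * m) (+-monoʳ-≤ (m * m) (*-monoʳ-≤ 2 (*-monoʳ-≤ m 2d≤m))) ⟩
    m * m + 2 * (m * m) + m * m                    ≤⟨ four≤five m ⟩
    5 * (m * m)                                    ∎
    where
    expand : ∀ d k → (3 * d + k) * (3 * d + k) ≡ (d + k) * (d + k) + 2 * ((d + k) * (2 * d)) + (2 * d) * (2 * d)
    expand = solve-∀
    four≤five : ∀ a → a * a + 2 * (a * a) + a * a ≤ 5 * (a * a)
    four≤five a = subst (_≤ 5 * (a * a)) (four a) (*-monoˡ-≤ (a * a) (n≤1+n 4))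
      where four : ∀ a → 4 * (a * a) ≡ a * a + 2 * (a * a) + a * a
            four = solve-∀
    4dd<mm : (2 * d) * (2 * d) < m * m
    4dd<mm = four-square<five-square d m 5dd<mm
    2d≤m : 2 * d ≤ m
    2d≤m = <⇒≤ (*-self-cancel-< {2 * d} 4dd<mm)

√5-above : ∀ d k → (3 * d + k) * (3 * d + k) < 5 * ((d + k) * (d + k)) → d ≤√5· k
√5-above d k h = ≮⇒≥ λ 5kk<dd → <⇒≱ h (ge 5kk<dd)
  where
  open ≤-Reasoning
  ge : 5 * (k * k) < d * d → 5 * ((d + k) * (d + k)) ≤ (3 * d + k) * (3 * d + k)
  ge 5kk<dd = begin
    5 * ((d + k) * (d + k))                                                        ≡⟨ expand d k ⟩
    (5 * (d * d) + 6 * (d * k) + k * k) + (2 * (d * (2 * k)) + (2 * k) * (2 * k))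
      ≤⟨ +-monoʳ-≤ (5 * (d * d) + 6 * (d * k) + k * k) (+-mono-≤ (*-monoʳ-≤ 2 (*-monoʳ-≤ d 2k≤d)) (<⇒≤ 4kk<dd)) ⟩
    (5 * (d * d) + 6 * (d * k) + k * k) + (2 * (d * d) + d * d)                    ≤⟨ m≤m+n _ (d * d) ⟩
    (5 * (d * d) + 6 * (d * k) + k * k) + (2 * (d * d) + d * d) + d * d            ≡⟨ collect d k ⟩
    (3 * d + k) * (3 * d + k)                                                      ∎
    where
    expand : ∀ d k → 5 * ((d + k) * (d + k)) ≡ (5 * (d * d) + 6 * (d * k) + k * k) + (2 * (d * (2 * k)) + (2 * k) * (2 * k))
    expand = solve-∀
    collect : ∀ d k → (5 * (d * d) + 6 * (d * k) + k * k) + (2 * (d * d) + d * d) + d * d ≡ (3 * d + k) * (3 * d + k)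
    collect = solve-∀
    4kk<dd : (2 * k) * (2 * k) < d * d
    4kk<dd = four-square<five-square k d 5kk<dd
    2k≤d : 2 * k ≤ d
    2k≤d = <⇒≤ (*-self-cancel-< {2 * k} 4kk<dd)

three-times-minus-twice : ∀ {k m} → k ≤ m → 3 * m ∸ 2 * k ≡ 3 * (m ∸ k) + k
three-times-minus-twice {k} {m} k≤m = begin
  3 * m ∸ 2 * k                       ≡⟨ cong (λ t → 3 * t ∸ 2 * k) (m∸n+n≡m k≤m) ⟨
  3 * (d + k) ∸ 2 * k                 ≡⟨ cong (_∸ 2 * k) (regroup d k) ⟩
  (3 * d + k) + 2 * k ∸ 2 * k         ≡⟨ m+n∸n≡m (3 * d + k) (2 * k) ⟩
  3 * d + k                           ∎
  where
  open ≡-Reasoning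
  d = m ∸ k
  regroup : ∀ d k → 3 * (d + k) ≡ (3 * d + k) + 2 * k
  regroup = solve-∀

threshold-false : ∀ {k m} → exceedsThreshold k m ≡ false → 5 * (m * m) ≤ (3 * m ∸ 2 * k) * (3 * m ∸ 2 * k)
threshold-false {k} {m} p with 3 * m <ᵇ 2 * k | (3 * m ∸ 2 * k) ^ 2 <ᵇ 5 * m ^ 2 in q
... | false | false = subst₂ _≤_ (cong (5 *_) (^2≡* m)) (^2≡* (3 * m ∸ 2 * k)) (≮⇒≥ {(3 * m ∸ 2 * k) ^ 2} {5 * m ^ 2} λ lt → subst T q (<⇒<ᵇ lt))

threshold-true : ∀ {k m} → k ≤ m → exceedsThreshold k m ≡ true → (3 * m ∸ 2 * k) * (3 * m ∸ 2 * k) < 5 * (m * m)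
threshold-true {k} {m} k≤m p with 3 * m <ᵇ 2 * k in q₁ | (3 * m ∸ 2 * k) ^ 2 <ᵇ 5 * m ^ 2 in q₂
... | true | _ = ⊥-elim (<⇒≱ (<ᵇ⇒< (3 * m) (2 * k) (subst T (sym q₁) _)) (*-mono-≤ (n≤1+n 2) k≤m))
... | false | true = subst₂ _<_ (^2≡* (3 * m ∸ 2 * k)) (cong (5 *_) (^2≡* m)) (<ᵇ⇒< _ _ (subst T (sym q₂) _))

below-threshold : ∀ {k m} → k ≤ m → exceedsThreshold k m ≡ false → m ≤√5· (m ∸ k)
below-threshold {k} {m} k≤m p = subst (_≤√5· (m ∸ k)) (m∸n+n≡m k≤m)
  (√5-below (m ∸ k) k (subst₂ (λ a b → 5 * (a * a) ≤ b * b) (sym (m∸n+n≡m k≤m)) (three-times-minus-twice k≤m) (threshold-false {k} {m} p)))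

above-threshold : ∀ {k m} → k ≤ m → exceedsThreshold k m ≡ true → m ∸ k ≤√5· k
above-threshold {k} {m} k≤m p = √5-above (m ∸ k) k
  (subst₂ (λ a b → a * a < 5 * (b * b)) (three-times-minus-twice k≤m) (sym (m∸n+n≡m k≤m)) (threshold-true {k} {m} k≤m p))

threshold-zero : ∀ m → exceedsThreshold 0 m ≡ false
threshold-zero m with 3 * m <ᵇ 0 in q₁ | (3 * m) ^ 2 <ᵇ 5 * m ^ 2 in q₂
... | false | false = refl
... | true | _ = ⊥-elim (n≮0 (<ᵇ⇒< (3 * m) 0 (subst T (sym q₁) _)))
... | false | true = ⊥-elim (<⇒≱ (<ᵇ⇒< _ _ (subst T (sym q₂) _)) five≤nine)
  where
  open ≤-Reasoning
  five≤nine : 5 * m ^ 2 ≤ (3 * m) ^ 2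
  five≤nine = begin
    5 * m ^ 2        ≤⟨ *-monoˡ-≤ (m ^ 2) (m≤m+n 5 4) ⟩
    9 * m ^ 2        ≡⟨ cong (9 *_) (^2≡* m) ⟩
    9 * (m * m)      ≡⟨ nine m ⟩
    3 * m * (3 * m)  ≡⟨ ^2≡* (3 * m) ⟨
    (3 * m) ^ 2      ∎
    where nine : ∀ m → 9 * (m * m) ≡ 3 * m * (3 * m)
          nine = solve-∀

∸-triangle : ∀ m e k → m ∸ k ≤ (m ∸ e) + (e ∸ k)
∸-triangle m e k = m≤n+o⇒m∸n≤o m k (begin
  m                              ≤⟨ m≤n+m∸n m e ⟩
  e + (m ∸ e)                    ≤⟨ +-monoˡ-≤ (m ∸ e) (m≤n+m∸n e k) ⟩
  k + (e ∸ k) + (m ∸ e)          ≡⟨ +-assoc k _ _ ⟩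
  k + ((e ∸ k) + (m ∸ e))        ≡⟨ cong (k +_) (+-comm (e ∸ k) (m ∸ e)) ⟩
  k + ((m ∸ e) + (e ∸ k))        ∎)
  where open ≤-Reasoning

when : Bool → ℕ → ℕ
when b n = if b then n else 0

-- One block between two distinct supernodes: m pairs, e of them in E, e₂ in E₂ and
-- k in E₃, r = e₂ - k removed by the loop, j records whether OPT joins the two
-- supernodes (and then they are not hostile, so e₂ = e).
block-bound : ∀ {m e e₂ k} (j : Bool) → k ≤ e₂ → e₂ ≤ e → e ≤ m → (j ≡ true → e₂ ≡ e) →
  let z = k ≡ᵇ 0
      r = e₂ ∸ k
      c₄ = if exceedsThreshold k m then m ∸ e else e
      cₒ = if j then m ∸ e else e
  in c₄ + when (not j ∧ not z) r ≤ cₒ + when (j ∧ z) r +√5· (when (j ∧ not z) (cₒ + r) + when (not j ∧ not z) cₒ)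
block-bound {m} {e} {e₂} {k} j k≤e₂ e₂≤e e≤m joined with exceedsThreshold k m in t
block-bound {m} {e} {e₂} {zero} true _ _ _ joined | true with () ← trans (sym t) (threshold-zero m)
block-bound {m} {e} {e₂} {zero} true _ _ _ joined | false rewrite joined refl =
  ≤⇒≤+√5· (subst (_≤ (m ∸ e) + e) (sym (+-identityʳ e)) (m≤n+m e (m ∸ e)))
block-bound {m} {e} {e₂} {suc k} true _ _ _ _ | true = ≤⇒≤+√5· ≤-refl
block-bound {m} {e} {e₂} {suc k} true k<e₂ e₂≤e e≤m joined | false rewrite joined refl =
  mk (≤√5·-mono {z = m ∸ suc k} (≤-trans (m∸n≤m (e + 0) ((m ∸ e) + 0)) (≤-trans (≤-reflexive (+-identityʳ e)) e≤m))
                (≤-trans (∸-triangle m e (suc k)) (m≤m+n _ 0))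
                (below-threshold (≤-trans k<e₂ (≤-trans e₂≤e e≤m)) t))
block-bound {m} {e} {e₂} {zero} false _ _ _ _ | true with () ← trans (sym t) (threshold-zero m)
block-bound {m} {e} {e₂} {zero} false _ _ _ _ | false = ≤⇒≤+√5· ≤-refl
block-bound {m} {e} {e₂} {suc k} false k<e₂ e₂≤e e≤m _ | true =
  mk (≤√5·-mono {z = suc k} (≤-trans (m≤n+o⇒m∸n≤o _ (e + 0) bound) (∸-monoʳ-≤ m k<e))
                k<e
                (above-threshold (≤-trans k<e e≤m) t))
  where
  k<e = ≤-trans k<e₂ e₂≤e
  bound : (m ∸ e) + (e₂ ∸ suc k) ≤ (e + 0) + (m ∸ e)
  bound = subst ((m ∸ e) + (e₂ ∸ suc k) ≤_) (+-comm (m ∸ e) (e + 0))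
            (+-monoʳ-≤ (m ∸ e) (≤-trans (m∸n≤m e₂ (suc k)) (≤-trans e₂≤e (m≤m+n e 0))))
block-bound {m} {e} {e₂} {suc k} false k<e₂ e₂≤e e≤m _ | false =
  mk (≤√5·-mono {z = e} (m≤n+o⇒m∸n≤o _ (e + 0) (≤-trans (+-monoʳ-≤ e (≤-trans (m∸n≤m e₂ (suc k)) e₂≤e)) (+-monoˡ-≤ e (m≤m+n e 0))))
                ≤-refl (≤√5·-refl e))

-- Used with j₀, j₁, s₀, s₊ the numbers of pairs removed by step 3 from blocks of the
-- kinds J₀, J₁, S₀, S₊ defined below, and w the √5-weighted part of the block bounds.
≤+√5·-discharge : ∀ {c₄ cₒ w j₀ j₁ s₀ s₊} → c₄ + s₊ ≤ cₒ + j₀ +√5· w →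
                  j₁ + j₀ ≤ s₀ + s₊ → j₁ ≤ s₀ → w + s₀ ≤ cₒ + j₁ → c₄ ≤ cₒ +√5· cₒ
≤+√5·-discharge {c₄} {cₒ} {w} {j₀} {j₁} {s₀} {s₊} summed charged j₁≤s₀ absorbed =
  ≤+√5·-mono ≤-refl ≤-refl w+d≤cₒ (≤+√5·-shift (s₀ ∸ j₁) (≤+√5·-cancel s₊ (≤+√5·-mono ≤-refl y-bound ≤-refl summed)))
  where
  open ≤-Reasoning
  y-bound : cₒ + j₀ ≤ cₒ + (s₀ ∸ j₁) + s₊
  y-bound = begin
    cₒ + j₀                  ≤⟨ +-monoʳ-≤ cₒ (m+n≤o⇒m≤o∸n j₀ (subst (_≤ s₀ + s₊) (+-comm j₁ j₀) charged)) ⟩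
    cₒ + (s₀ + s₊ ∸ j₁)      ≡⟨ cong (cₒ +_) (+-∸-comm s₊ j₁≤s₀) ⟩
    cₒ + ((s₀ ∸ j₁) + s₊)    ≡⟨ +-assoc cₒ _ _ ⟨
    cₒ + (s₀ ∸ j₁) + s₊      ∎
  w+d≤cₒ : w + (s₀ ∸ j₁) ≤ cₒ
  w+d≤cₒ = begin
    w + (s₀ ∸ j₁)            ≡⟨ +-∸-assoc w j₁≤s₀ ⟨
    w + s₀ ∸ j₁              ≤⟨ ∸-monoˡ-≤ j₁ absorbed ⟩
    cₒ + j₁ ∸ j₁             ≡⟨ m+n∸n≡m cₒ j₁ ⟩
    cₒ                       ∎

-- Finite double sums

∑∑ : (Fin n → Fin n → ℕ) → ℕ
∑∑ {n} f = ∑[ i < n ] ∑[ j < n ] f i j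

listSum≡∑ : (f : Fin n → ℕ) → List.sum (map f (allFin n)) ≡ ∑[ i < n ] f i
listSum≡∑ {n} f = trans (cong List.sum (map-tabulate id f)) (tabulate-sum n f)
  where
  tabulate-sum : ∀ n (f : Fin n → ℕ) → List.sum (tabulate f) ≡ ∑[ i < n ] f i
  tabulate-sum zero f = refl
  tabulate-sum (suc n) f = cong (f zero +_) (tabulate-sum n (f ∘ suc))

∑-mono-≤ : {f g : Fin n → ℕ} → (∀ i → f i ≤ g i) → ∑[ i < n ] f i ≤ ∑[ i < n ] g i
∑-mono-≤ {zero} f≤g = z≤n
∑-mono-≤ {suc n} f≤g = +-mono-≤ (f≤g zero) (∑-mono-≤ (f≤g ∘ suc))

∑-nonzero : (f : Fin n → ℕ) → ∑[ i < n ] f i ≢ 0 → ∃ λ i → f i ≢ 0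
∑-nonzero {zero} f ∑≢0 = contradiction refl ∑≢0
∑-nonzero {suc n} f ∑≢0 with f zero ℕ.≟ 0
... | no f0≢0 = zero , f0≢0
... | yes f0≡0 with ∑-nonzero (f ∘ suc) (λ ∑≡0 → ∑≢0 (cong₂ _+_ f0≡0 ∑≡0))
...   | i , fi≢0 = suc i , fi≢0

∑-update : (c : Fin n) (f g : Fin n → ℕ) → (∀ i → i ≢ c → f i ≡ g i) →
           ∑[ i < n ] f i + g c ≡ ∑[ i < n ] g i + f c
∑-update {suc n} zero f g f≗g = begin
  f zero + ∑[ i < n ] f (suc i) + g zero  ≡⟨ cong (λ t → f zero + t + g zero) (sum-cong-≗ (λ i → f≗g (suc i) λ ())) ⟩
  f zero + ∑[ i < n ] g (suc i) + g zero  ≡⟨ swap-ends (f zero) _ (g zero) ⟩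
  g zero + ∑[ i < n ] g (suc i) + f zero  ∎
  where
  open ≡-Reasoning
  swap-ends : ∀ a b c → a + b + c ≡ c + b + a
  swap-ends = solve-∀
∑-update {suc n} (suc c) f g f≗g = begin
  f zero + ∑[ i < n ] f (suc i) + g (suc c)    ≡⟨ +-assoc (f zero) _ _ ⟩
  f zero + (∑[ i < n ] f (suc i) + g (suc c))  ≡⟨ cong₂ _+_ (f≗g zero λ ()) (∑-update c (f ∘ suc) (g ∘ suc) λ i i≢c → f≗g (suc i) (i≢c ∘ suc-injective)) ⟩
  g zero + (∑[ i < n ] g (suc i) + f (suc c))  ≡⟨ +-assoc (g zero) _ _ ⟨
  g zero + ∑[ i < n ] g (suc i) + f (suc c)    ∎
  where open ≡-Reasoning

∑-single : (c : Fin n) (f : Fin n → ℕ) → (∀ i → i ≢ c → f i ≡ 0) → ∑[ i < n ] f i ≡ f c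
∑-single {n} c f f≗0 = +-cancelʳ-≡ 0 _ _ (begin
  ∑[ i < n ] f i + 0  ≡⟨ ∑-update c f (λ _ → 0) f≗0 ⟩
  ∑[ i < n ] 0 + f c  ≡⟨ cong (_+ f c) (sum-replicate-zero n) ⟩
  f c                 ≡⟨ +-identityʳ (f c) ⟨
  f c + 0             ∎)
  where open ≡-Reasoning

∑∑-cong : {f g : Fin n → Fin n → ℕ} → (∀ i j → f i j ≡ g i j) → ∑∑ f ≡ ∑∑ g
∑∑-cong f≗g = sum-cong-≗ λ i → sum-cong-≗ (f≗g i)

∑∑-mono-≤ : {f g : Fin n → Fin n → ℕ} → (∀ i j → f i j ≤ g i j) → ∑∑ f ≤ ∑∑ g
∑∑-mono-≤ f≤g = ∑-mono-≤ λ i → ∑-mono-≤ (f≤g i)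

∑∑-distrib-+ : (f g : Fin n → Fin n → ℕ) → ∑∑ (λ i j → f i j + g i j) ≡ ∑∑ f + ∑∑ g
∑∑-distrib-+ {n} f g = trans (sum-cong-≗ λ i → ∑-distrib-+ (f i) (g i)) (∑-distrib-+ (λ i → ∑[ j < n ] f i j) _)

∑∑-transpose : (f : Fin n → Fin n → ℕ) → ∑∑ f ≡ ∑∑ (λ i j → f j i)
∑∑-transpose f = ∑-comm f

∑∑-zero : ∑∑ {n} (λ _ _ → 0) ≡ 0
∑∑-zero {n} = trans (sum-cong-≗ {n} λ _ → sum-replicate-zero n) (sum-replicate-zero n)

∑∑-comm : (f : Fin n → Fin n → Fin n → Fin n → ℕ) →
          ∑∑ (λ a b → ∑∑ (λ U W → f a b U W)) ≡ ∑∑ (λ U W → ∑∑ (λ a b → f a b U W))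
∑∑-comm {n} f = begin
  ∑[ a < n ] ∑[ b < n ] ∑[ U < n ] ∑[ W < n ] f a b U W  ≡⟨ sum-cong-≗ (λ a → ∑-comm λ b U → ∑[ W < n ] f a b U W) ⟩
  ∑[ a < n ] ∑[ U < n ] ∑[ b < n ] ∑[ W < n ] f a b U W  ≡⟨ ∑-comm (λ a U → ∑[ b < n ] ∑[ W < n ] f a b U W) ⟩
  ∑[ U < n ] ∑[ a < n ] ∑[ b < n ] ∑[ W < n ] f a b U W  ≡⟨ sum-cong-≗ (λ U → sum-cong-≗ λ a → ∑-comm λ b W → f a b U W) ⟩
  ∑[ U < n ] ∑[ a < n ] ∑[ W < n ] ∑[ b < n ] f a b U W  ≡⟨ sum-cong-≗ (λ U → ∑-comm λ a W → ∑[ b < n ] f a b U W) ⟩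
  ∑[ U < n ] ∑[ W < n ] ∑[ a < n ] ∑[ b < n ] f a b U W  ∎
  where open ≡-Reasoning

∑∑-update : (a b : Fin n) (f g : Fin n → Fin n → ℕ) → (∀ i j → (i ≡ a → j ≢ b) → f i j ≡ g i j) →
            ∑∑ f + g a b ≡ ∑∑ g + f a b
∑∑-update {n} a b f g f≗g = +-cancelʳ-≡ (∑ g a) _ _ (begin
  F + g a b + ∑ g a    ≡⟨ +-right-comm F (g a b) (∑ g a) ⟩
  F + ∑ g a + g a b    ≡⟨ cong (_+ g a b) rows ⟩
  G + ∑ f a + g a b    ≡⟨ +-assoc G _ _ ⟩
  G + (∑ f a + g a b)  ≡⟨ cong (G +_) row-a ⟩
  G + (∑ g a + f a b)  ≡⟨ +-comm-inner G (∑ g a) (f a b) ⟩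
  G + f a b + ∑ g a    ∎)
  where
  open ≡-Reasoning
  ∑ : (Fin n → Fin n → ℕ) → Fin n → ℕ
  ∑ h i = ∑[ j < n ] h i j
  F = ∑∑ f
  G = ∑∑ g
  rows : F + ∑ g a ≡ G + ∑ f a
  rows = ∑-update a (∑ f) (∑ g) λ i i≢a → sum-cong-≗ λ j → f≗g i j λ i≡a → contradiction i≡a i≢a
  row-a : ∑ f a + g a b ≡ ∑ g a + f a b
  row-a = ∑-update b (f a) (g a) λ j j≢b → f≗g a j λ _ → j≢b
  +-right-comm : ∀ x y z → x + y + z ≡ x + z + y
  +-right-comm = solve-∀
  +-comm-inner : ∀ x y z → x + (y + z) ≡ x + z + y
  +-comm-inner = solve-∀

-- Goes through the intermediate function that agrees with g at (a, b) and with f elsewhere.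
∑∑-update₂ : (a b : Fin n) (f g : Fin n → Fin n → ℕ) → a ≢ b →
             (∀ i j → (i ≡ a → j ≢ b) → (i ≡ b → j ≢ a) → f i j ≡ g i j) →
             ∑∑ f + (g a b + g b a) ≡ ∑∑ g + (f a b + f b a)
∑∑-update₂ a b f g a≢b f≗g = begin
  ∑∑ f + (g a b + g b a)   ≡⟨ +-assoc (∑∑ f) _ _ ⟨
  ∑∑ f + g a b + g b a     ≡⟨ cong (λ t → ∑∑ f + t + g b a) h-ab ⟨
  ∑∑ f + h a b + g b a     ≡⟨ cong (_+ g b a) (∑∑-update a b f h f≗h) ⟩
  ∑∑ h + f a b + g b a     ≡⟨ +-right-comm (∑∑ h) (f a b) (g b a) ⟩
  ∑∑ h + g b a + f a b     ≡⟨ cong (_+ f a b) (∑∑-update b a h g h≗g) ⟩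
  ∑∑ g + h b a + f a b     ≡⟨ cong (λ t → ∑∑ g + t + f a b) h-ba ⟩
  ∑∑ g + f b a + f a b     ≡⟨ +-assoc (∑∑ g) _ _ ⟩
  ∑∑ g + (f b a + f a b)   ≡⟨ cong (∑∑ g +_) (+-comm (f b a) (f a b)) ⟩
  ∑∑ g + (f a b + f b a)   ∎
  where
  open ≡-Reasoning
  +-right-comm : ∀ x y z → x + y + z ≡ x + z + y
  +-right-comm = solve-∀
  h : Fin _ → Fin _ → ℕ
  h i j with i ≟ a | j ≟ b
  ... | yes _ | yes _ = g i j
  ... | _     | _     = f i j
  f≗h : ∀ i j → (i ≡ a → j ≢ b) → f i j ≡ h i j
  f≗h i j ¬ab with i ≟ a | j ≟ b
  ... | yes i≡a | yes j≡b = contradiction j≡b (¬ab i≡a)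
  ... | yes _   | no _    = refl
  ... | no _    | _       = refl
  h≗g : ∀ i j → (i ≡ b → j ≢ a) → h i j ≡ g i j
  h≗g i j ¬ba with i ≟ a | j ≟ b
  ... | yes _   | yes _   = refl
  ... | yes i≡a | no j≢b  = f≗g i j (λ _ → j≢b) (λ i≡b → contradiction (trans (sym i≡a) i≡b) a≢b)
  ... | no i≢a  | _       = f≗g i j (λ i≡a → contradiction i≡a i≢a) ¬ba
  h-ab : h a b ≡ g a b
  h-ab with a ≟ a | b ≟ b
  ... | yes _ | yes _ = refl
  ... | no a≢a | _ = contradiction refl a≢a
  ... | yes _ | no b≢b = contradiction refl b≢b
  h-ba : h b a ≡ f b a
  h-ba with b ≟ a
  ... | yes b≡a = contradiction (sym b≡a) a≢b
  ... | no _ = refl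

≤+√5·-∑ : {x y z : Fin n → ℕ} → (∀ i → x i ≤ y i +√5· z i) →
          ∑[ i < n ] x i ≤ ∑[ i < n ] y i +√5· ∑[ i < n ] z i
≤+√5·-∑ {zero} _ = ≤⇒≤+√5· z≤n
≤+√5·-∑ {suc n} bound = ≤+√5·-+ (bound zero) (≤+√5·-∑ (bound ∘ suc))

≤+√5·-∑∑ : {x y z : Fin n → Fin n → ℕ} → (∀ i j → x i j ≤ y i j +√5· z i j) → ∑∑ x ≤ ∑∑ y +√5· ∑∑ z
≤+√5·-∑∑ bound = ≤+√5·-∑ λ i → ≤+√5·-∑ (bound i)

-- Pairs of vertices and blocks between supernodes

𝟙 : Bool → ℕ
𝟙 b = if b then 1 else 0

𝟙≢0⇒T : ∀ {x} → 𝟙 x ≢ 0 → T x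
𝟙≢0⇒T {true}  _   = _
𝟙≢0⇒T {false} 0≢0 = ⊥-elim (0≢0 refl)

𝟙-mono : ∀ {x y} → (T x → T y) → 𝟙 x ≤ 𝟙 y
𝟙-mono {false}         _   = z≤n
𝟙-mono {true} {true}   _   = ≤-refl
𝟙-mono {true} {false}  x⇒y = ⊥-elim (x⇒y _)

T-ext : ∀ {x y} → (T x → T y) → (T y → T x) → x ≡ y
T-ext {false} {false} _ _ = refl
T-ext {false} {true}  _ y⇒x = ⊥-elim (y⇒x _)
T-ext {true}  {false} x⇒y _ = ⊥-elim (x⇒y _)
T-ext {true}  {true}  _ _ = refl

==ᵇ-refl : (i : Fin n) → (i ==ᵇ i) ≡ true
==ᵇ-refl i = trans (isYes≗does (i ≟ i)) (dec-true (i ≟ i) refl)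

≡⇒==ᵇ : {i j : Fin n} → i ≡ j → (i ==ᵇ j) ≡ true
≡⇒==ᵇ {j = j} refl = ==ᵇ-refl j

≢⇒==ᵇ : {i j : Fin n} → i ≢ j → (i ==ᵇ j) ≡ false
≢⇒==ᵇ {i = i} {j} i≢j = trans (isYes≗does (i ≟ j)) (dec-false (i ≟ j) i≢j)

==ᵇ⇒≡ : {i j : Fin n} → (i ==ᵇ j) ≡ true → i ≡ j
==ᵇ⇒≡ {i = i} {j} p = toWitness (subst T (sym p) _)

==ᵇ-sym : (i j : Fin n) → (i ==ᵇ j) ≡ (j ==ᵇ i)
==ᵇ-sym i j = trans (isYes≗does (i ≟ j)) (trans (does-⇔ (mk⇔ sym sym) (i ≟ j) (j ≟ i)) (sym (isYes≗does (j ≟ i))))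

∑-select : (c : Fin n) (f : Bool → Fin n → ℕ) → (∀ i → f false i ≡ 0) → ∑[ i < n ] f (c ==ᵇ i) i ≡ f true c
∑-select c f f-false = trans (∑-single c _ off-c) (cong (λ t → f t c) (==ᵇ-refl c))
  where
  off-c : ∀ i → i ≢ c → f (c ==ᵇ i) i ≡ 0
  off-c i i≢c rewrite ≢⇒==ᵇ (i≢c ∘ sym) = f-false i

⟦⟧-sym : (P : PairMat n) (i j : Fin n) → ⟦ P ⟧ i j ≡ ⟦ P ⟧ j i
⟦⟧-sym P i j = cong₂ _∧_ (cong not (==ᵇ-sym i j)) (∨-comm (P i j) (P j i))

⟦⟧-irrefl : (P : PairMat n) (i : Fin n) → ⟦ P ⟧ i i ≡ false
⟦⟧-irrefl P i rewrite ==ᵇ-refl i = refl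

⟦⟧-both : (P : PairMat n) {i j : Fin n} {c : Bool} → P i j ≡ c → P j i ≡ c → ⟦ P ⟧ i j ≡ (i ≠ᵇ j) ∧ c
⟦⟧-both P {i} {j} {c} Pij Pji rewrite Pij | Pji = cong ((i ≠ᵇ j) ∧_) (∨-idem c)

∑∑-symmetric : (Q : Fin n → Fin n → Bool) → (∀ i j → Q i j ≡ Q j i) → (∀ i → Q i i ≡ false) →
               ∑∑ (λ i j → 𝟙 (Q i j)) ≡ 2 * ∑∑ (λ i j → 𝟙 (⌊ i <? j ⌋ ∧ Q i j))
∑∑-symmetric Q Q-sym Q-irrefl = begin
  ∑∑ (λ i j → 𝟙 (Q i j))                                  ≡⟨ ∑∑-cong split ⟩
  ∑∑ (λ i j → 𝟙 (lt i j ∧ Q i j) + 𝟙 (lt j i ∧ Q j i))    ≡⟨ ∑∑-distrib-+ (λ i j → 𝟙 (lt i j ∧ Q i j)) _ ⟩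
  A + ∑∑ (λ i j → 𝟙 (lt j i ∧ Q j i))                     ≡⟨ cong (A +_) (∑∑-transpose (λ i j → 𝟙 (lt i j ∧ Q i j))) ⟨
  A + A                                                   ≡⟨ cong (A +_) (+-identityʳ A) ⟨
  2 * A                                                   ∎
  where
  open ≡-Reasoning
  lt : Fin _ → Fin _ → Bool
  lt i j = ⌊ i <? j ⌋
  A = ∑∑ (λ i j → 𝟙 (lt i j ∧ Q i j))
  split : ∀ i j → 𝟙 (Q i j) ≡ 𝟙 (lt i j ∧ Q i j) + 𝟙 (lt j i ∧ Q j i)
  split i j with <-cmp i j | i <? j | j <? i
  ... | tri< i<j _ _ | yes _    | no _     = sym (+-identityʳ _)
  ... | tri< i<j _ _ | _        | yes j<i  = contradiction j<i (<-asym i<j)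
  ... | tri< i<j _ _ | no i≮j   | _        = contradiction i<j i≮j
  ... | tri> _ _ j<i | no _     | yes _    = cong 𝟙 (Q-sym i j)
  ... | tri> _ _ j<i | yes i<j  | _        = contradiction j<i (<-asym i<j)
  ... | tri> _ _ j<i | _        | no j≮i   = contradiction j<i j≮i
  ... | tri≈ _ refl _ | i<?i    | i<?i′    rewrite Q-irrefl i = sym (cong₂ _+_ (cong 𝟙 (∧-zeroʳ ⌊ i<?i ⌋)) (cong 𝟙 (∧-zeroʳ ⌊ i<?i′ ⌋)))

⟦⟧-of-symmetric : (Q : PairMat n) → (∀ i j → Q i j ≡ Q j i) → (∀ i → Q i i ≡ false) →
                  ∀ i j → ⟦ Q ⟧ i j ≡ Q i j
⟦⟧-of-symmetric Q Q-sym Q-irrefl i j with i ≟ j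
... | yes refl = sym (Q-irrefl i)
... | no _ rewrite Q-sym j i = ∨-idem (Q i j)

pairCount≡∑∑ : (P : PairMat n) → pairCount P ≡ ∑∑ (λ i j → 𝟙 (⌊ i <? j ⌋ ∧ ⟦ P ⟧ i j))
pairCount≡∑∑ {n} P = trans (listSum≡∑ (λ i → List.sum (map (λ j → 𝟙 (⌊ i <? j ⌋ ∧ ⟦ P ⟧ i j)) (allFin n))))
                           (sum-cong-≗ λ i → listSum≡∑ (λ j → 𝟙 (⌊ i <? j ⌋ ∧ ⟦ P ⟧ i j)))

symDiff≡∑∑ : (A B : PairMat n) → 2 * symDiff A B ≡ ∑∑ (λ i j → 𝟙 (⟦ A ⟧ i j xor ⟦ B ⟧ i j))
symDiff≡∑∑ A B = begin
  2 * symDiff A B                                  ≡⟨ cong (2 *_) (pairCount≡∑∑ A△B) ⟩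
  2 * ∑∑ (λ i j → 𝟙 (⌊ i <? j ⌋ ∧ ⟦ A△B ⟧ i j))    ≡⟨ cong (2 *_) (∑∑-cong λ i j → cong (λ b → 𝟙 (⌊ i <? j ⌋ ∧ b)) (⟦⟧-of-symmetric A△B A△B-sym A△B-irrefl i j)) ⟩
  2 * ∑∑ (λ i j → 𝟙 (⌊ i <? j ⌋ ∧ A△B i j))        ≡⟨ ∑∑-symmetric A△B A△B-sym A△B-irrefl ⟨
  ∑∑ (λ i j → 𝟙 (A△B i j))                         ∎
  where
  open ≡-Reasoning
  A△B : PairMat _
  A△B i j = ⟦ A ⟧ i j xor ⟦ B ⟧ i j
  A△B-sym : ∀ i j → A△B i j ≡ A△B j i
  A△B-sym i j = cong₂ _xor_ (⟦⟧-sym A i j) (⟦⟧-sym B i j)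
  A△B-irrefl : ∀ i → A△B i i ≡ false
  A△B-irrefl i = cong₂ _xor_ (⟦⟧-irrefl A i) (⟦⟧-irrefl B i)

module _ {n : ℕ} (s : Fin n → Fin n) where

  inBlock : Fin n → Fin n → (Fin n → Fin n → Bool) → Fin n → Fin n → Bool
  inBlock U W g a b = (s a ==ᵇ U) ∧ ((s b ==ᵇ W) ∧ g a b)

  blockCount : (Fin n → Fin n → Bool) → Fin n → Fin n → ℕ
  blockCount g U W = ∑∑ λ a b → 𝟙 (inBlock U W g a b)

  ∑∑-blockCount : (g : Fin n → Fin n → Bool) → ∑∑ (λ a b → 𝟙 (g a b)) ≡ ∑∑ (blockCount g)
  ∑∑-blockCount g = trans (∑∑-cong by-blocks) (∑∑-comm λ a b U W → 𝟙 (inBlock U W g a b))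
    where
    by-blocks : ∀ a b → 𝟙 (g a b) ≡ ∑∑ (λ U W → 𝟙 (inBlock U W g a b))
    by-blocks a b = sym (trans
      (∑-select (s a) (λ t U → ∑[ W < n ] 𝟙 (t ∧ ((s b ==ᵇ W) ∧ g a b))) (λ _ → sum-replicate-zero n))
      (∑-select (s b) (λ t W → 𝟙 (t ∧ g a b)) (λ _ → refl)))

  inBlock-pointwise : (R : ℕ → ℕ → Set) → R 0 0 → {g h : Fin n → Fin n → Bool} {U W : Fin n} →
    (∀ a b → s a ≡ U → s b ≡ W → R (𝟙 (g a b)) (𝟙 (h a b))) →
    ∀ a b → R (𝟙 (inBlock U W g a b)) (𝟙 (inBlock U W h a b))
  inBlock-pointwise R R00 {U = U} {W} gRh a b with s a ==ᵇ U in a∈U | s b ==ᵇ W in b∈W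
  ... | false | _     = R00
  ... | true  | false = R00
  ... | true  | true  = gRh a b (==ᵇ⇒≡ a∈U) (==ᵇ⇒≡ b∈W)

  blockCount-cong : {g h : Fin n → Fin n → Bool} {U W : Fin n} →
    (∀ a b → s a ≡ U → s b ≡ W → g a b ≡ h a b) → blockCount g U W ≡ blockCount h U W
  blockCount-cong g≗h = ∑∑-cong (inBlock-pointwise _≡_ refl λ a b a∈U b∈W → cong 𝟙 (g≗h a b a∈U b∈W))

  blockCount-mono : {g h : Fin n → Fin n → Bool} {U W : Fin n} →
    (∀ a b → s a ≡ U → s b ≡ W → T (g a b) → T (h a b)) → blockCount g U W ≤ blockCount h U W
  blockCount-mono g⇒h = ∑∑-mono-≤ (inBlock-pointwise _≤_ z≤n λ a b a∈U b∈W → 𝟙-mono (g⇒h a b a∈U b∈W))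

  blockCount-split : (g h : Fin n → Fin n → Bool) (U W : Fin n) →
    blockCount g U W ≡ blockCount (λ a b → g a b ∧ h a b) U W + blockCount (λ a b → g a b ∧ not (h a b)) U W
  blockCount-split g h U W = trans (∑∑-cong λ a b → split (s a ==ᵇ U) (s b ==ᵇ W) (g a b) (h a b))
                                   (∑∑-distrib-+ (λ a b → 𝟙 (inBlock U W (λ a b → g a b ∧ h a b) a b)) _)
    where
    split : ∀ x y g h → 𝟙 (x ∧ (y ∧ g)) ≡ 𝟙 (x ∧ (y ∧ (g ∧ h))) + 𝟙 (x ∧ (y ∧ (g ∧ not h)))
    split false _     _     _     = refl
    split true  false _     _     = refl
    split true  true  false _     = refl
    split true  true  true  true  = refl
    split true  true  true  false = refl

  blockSize : Fin n → Fin n → ℕ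
  blockSize = blockCount λ _ _ → true

  blockCount≤blockSize : (g : Fin n → Fin n → Bool) (U W : Fin n) → blockCount g U W ≤ blockSize U W
  blockCount≤blockSize g U W = blockCount-mono λ _ _ _ _ _ → _

  blockCount-xor : (g X : Fin n → Fin n → Bool) (U W : Fin n) (t : Bool) →
    (∀ a b → s a ≡ U → s b ≡ W → X a b ≡ t) →
    blockCount (λ a b → g a b xor X a b) U W ≡ (if t then blockSize U W ∸ blockCount g U W else blockCount g U W)
  blockCount-xor g X U W false X≡f = blockCount-cong λ a b a∈U b∈W → trans (cong (g a b xor_) (X≡f a b a∈U b∈W)) (xor-identityʳ _)
  blockCount-xor g X U W true X≡t = begin
    blockCount (λ a b → g a b xor X a b) U W                            ≡⟨ blockCount-cong (λ a b a∈U b∈W → trans (cong (g a b xor_) (X≡t a b a∈U b∈W)) (xor-comm (g a b) true)) ⟩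
    blockCount (λ a b → not (g a b)) U W                                ≡⟨ m+n∸m≡n (blockCount g U W) _ ⟨
    blockCount g U W + blockCount (λ a b → not (g a b)) U W ∸ blockCount g U W  ≡⟨ cong (_∸ blockCount g U W) (blockCount-split (λ _ _ → true) g U W) ⟨
    blockSize U W ∸ blockCount g U W                                    ∎
    where open ≡-Reasoning

  blockCount-transpose : (g : Fin n → Fin n → Bool) (U W : Fin n) → blockCount g U W ≡ blockCount (λ a b → g b a) W U
  blockCount-transpose g U W = trans (∑∑-transpose λ a b → 𝟙 (inBlock U W g a b))
                                     (∑∑-cong λ a b → cong 𝟙 (∧-swap (s b ==ᵇ U) (s a ==ᵇ W) (g b a)))
    where
    ∧-swap : ∀ x y z → x ∧ (y ∧ z) ≡ y ∧ (x ∧ z)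
    ∧-swap true  y z = refl
    ∧-swap false true  z = refl
    ∧-swap false false z = refl

  blockCount-guard : (c : Bool) (g : Fin n → Fin n → Bool) (U W : Fin n) →
    blockCount (λ a b → c ∧ g a b) U W ≡ when c (blockCount g U W)
  blockCount-guard true  g U W = refl
  blockCount-guard false g U W =
    trans (∑∑-cong λ a b → cong 𝟙 (trans (cong ((s a ==ᵇ U) ∧_) (∧-zeroʳ (s b ==ᵇ W))) (∧-zeroʳ (s a ==ᵇ U)))) (∑∑-zero {n})

  inBlock⁻ : (g : Fin n → Fin n → Bool) {U W a b : Fin n} →
    T (inBlock U W g a b) → s a ≡ U × s b ≡ W × T (g a b)
  inBlock⁻ g {U} {W} {a} {b} h with s a ==ᵇ U in a∈U | s b ==ᵇ W in b∈W
  ... | true  | true  = ==ᵇ⇒≡ a∈U , ==ᵇ⇒≡ b∈W , h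
  ... | true  | false = ⊥-elim h
  ... | false | _     = ⊥-elim h

  inBlock⁺ : (g : Fin n → Fin n → Bool) {a b : Fin n} → T (g a b) → T (inBlock (s a) (s b) g a b)
  inBlock⁺ g {a} {b} gab rewrite ==ᵇ-refl (s a) | ==ᵇ-refl (s b) = gab

  blockCount-nonzero : (g : Fin n → Fin n → Bool) (U W : Fin n) → blockCount g U W ≢ 0 →
    ∃₂ λ a b → s a ≡ U × s b ≡ W × T (g a b)
  blockCount-nonzero g U W count≢0 with ∑-nonzero _ count≢0
  ... | a , row≢0 with ∑-nonzero _ row≢0
  ...   | b , 𝟙≢0 = a , b , inBlock⁻ g (𝟙≢0⇒T 𝟙≢0)

  anyInBlock : (Fin n → Fin n → Bool) → Fin n → Fin n → Bool
  anyInBlock g U W = any (λ a → any (λ b → inBlock U W g a b) (allFin n)) (allFin n)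

  anyInBlock⁻ : (g : Fin n → Fin n → Bool) {U W : Fin n} → T (anyInBlock g U W) →
    ∃₂ λ a b → s a ≡ U × s b ≡ W × T (g a b)
  anyInBlock⁻ g h with satisfied (any⁻ _ (allFin n) h)
  ... | a , h′ with satisfied (any⁻ _ (allFin n) h′)
  ...   | b , h″ = a , b , inBlock⁻ g h″

  anyInBlock⁺ : (g : Fin n → Fin n → Bool) {a b : Fin n} → T (g a b) → T (anyInBlock g (s a) (s b))
  anyInBlock⁺ g {a} {b} gab = any⁺ _ (lose (∈-allFin a) (any⁺ _ (lose (∈-allFin b) (inBlock⁺ g gab))))

  crossCount≡blockCount : (P : PairMat n) (U W : Fin n) → crossCount s P U W ≡ blockCount ⟦ P ⟧ U W
  crossCount≡blockCount P U W =
    trans (listSum≡∑ λ a → List.sum (map (λ b → 𝟙 (inBlock U W ⟦ P ⟧ a b)) (allFin n)))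
          (sum-cong-≗ λ a → listSum≡∑ λ b → 𝟙 (inBlock U W ⟦ P ⟧ a b))

  crossSize≡blockSize : (U W : Fin n) → crossSize s U W ≡ blockSize U W
  crossSize≡blockSize U W =
    trans (listSum≡∑ λ a → List.sum (map (λ b → 𝟙 ((s a ==ᵇ U) ∧ (s b ==ᵇ W))) (allFin n)))
          (sum-cong-≗ λ a → trans (listSum≡∑ λ b → 𝟙 ((s a ==ᵇ U) ∧ (s b ==ᵇ W)))
                                  (sum-cong-≗ λ b → cong (λ t → 𝟙 ((s a ==ᵇ U) ∧ t)) (sym (∧-identityʳ (s b ==ᵇ W)))))

  crossCount-sym : (P : PairMat n) (U W : Fin n) → crossCount s P U W ≡ crossCount s P W U
  crossCount-sym P U W = begin
    crossCount s P U W                 ≡⟨ crossCount≡blockCount P U W ⟩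
    blockCount ⟦ P ⟧ U W               ≡⟨ blockCount-transpose ⟦ P ⟧ U W ⟩
    blockCount (λ a b → ⟦ P ⟧ b a) W U ≡⟨ blockCount-cong (λ a b _ _ → ⟦⟧-sym P b a) ⟩
    blockCount ⟦ P ⟧ W U               ≡⟨ crossCount≡blockCount P W U ⟨
    crossCount s P W U                 ∎
    where open ≡-Reasoning

  crossSize-sym : (U W : Fin n) → crossSize s U W ≡ crossSize s W U
  crossSize-sym U W = trans (crossSize≡blockSize U W) (trans (blockCount-transpose _ U W) (sym (crossSize≡blockSize W U)))

-- The loop of step 3

_⊆_ : PairMat n → PairMat n → Set
P ⊆ Q = ∀ i j → T (⟦ P ⟧ i j) → T (⟦ Q ⟧ i j)

⟦⟧-mono : {P Q : PairMat n} → (∀ i j → T (P i j) → T (Q i j)) → P ⊆ Q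
⟦⟧-mono {P = P} {Q} P⇒Q i j with i ≠ᵇ j
... | false = λ ()
... | true  = Equivalence.from T-∨ ∘ Sum.map (P⇒Q i j) (P⇒Q j i) ∘ Equivalence.to T-∨

removePair-⊆ : (a b : Fin n) (P : PairMat n) → removePair a b P ⊆ P
removePair-⊆ a b P = ⟦⟧-mono λ i j → kept (((i ==ᵇ a) ∧ (j ==ᵇ b)) ∨ ((i ==ᵇ b) ∧ (j ==ᵇ a)))
  where
  kept : ∀ c {x} → T (if c then false else x) → T x
  kept false h = h

pair-mismatch : {i j a b : Fin n} → (i ≡ a → j ≢ b) → ((i ==ᵇ a) ∧ (j ==ᵇ b)) ≡ false
pair-mismatch {i = i} {j} {a} {b} ¬ab with i ==ᵇ a in i≡a | j ==ᵇ b in j≡b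
... | false | _     = refl
... | true  | false = refl
... | true  | true  = contradiction (==ᵇ⇒≡ j≡b) (¬ab (==ᵇ⇒≡ i≡a))

removePair-elsewhere : (a b : Fin n) (P : PairMat n) {i j : Fin n} → (i ≡ a → j ≢ b) → (i ≡ b → j ≢ a) →
                       ⟦ removePair a b P ⟧ i j ≡ ⟦ P ⟧ i j
removePair-elsewhere a b P {i} {j} ¬ab ¬ba
  rewrite pair-mismatch {i = i} {j} ¬ab | pair-mismatch {i = i} {j} ¬ba
        | pair-mismatch {i = j} {i} (λ j≡a i≡b → ¬ba i≡b j≡a) | pair-mismatch {i = j} {i} (λ j≡b i≡a → ¬ab i≡a j≡b) = refl

removePair-removed : (a b : Fin n) (P : PairMat n) → ⟦ removePair a b P ⟧ a b ≡ false
removePair-removed a b P rewrite ==ᵇ-refl a | ==ᵇ-refl b | ∨-zeroʳ ((b ==ᵇ a) ∧ (a ==ᵇ b)) = ∧-zeroʳ (a ≠ᵇ b)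

removed : (X : Fin n → Fin n → Bool) (B P : PairMat n) → ℕ
removed X B P = ∑∑ λ i j → 𝟙 (X i j ∧ (⟦ B ⟧ i j ∧ not (⟦ P ⟧ i j)))

removed-removePair : (X : Fin n → Fin n → Bool) {B P : PairMat n} (a b : Fin n) → P ⊆ B → a ≢ b → T (⟦ P ⟧ a b) →
                     removed X B (removePair a b P) ≡ removed X B P + (𝟙 (X a b) + 𝟙 (X b a))
removed-removePair X {B} {P} a b P⊆B a≢b ab∈P = begin
  removed X B P′                                           ≡⟨ +-identityʳ _ ⟨
  removed X B P′ + 0                                       ≡⟨ cong (removed X B P′ +_) (cong₂ _+_ (still a b ab∈P) (still b a ba∈P)) ⟨
  removed X B P′ + (gain P a b + gain P b a)               ≡⟨ ∑∑-update₂ a b (gain P) (gain P′) a≢b unchanged ⟨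
  removed X B P + (gain P′ a b + gain P′ b a)              ≡⟨ cong (removed X B P +_) (cong₂ _+_ (now a b (removePair-removed a b P) ab∈P)
                                                                                                 (now b a ba∉P′ ba∈P)) ⟩
  removed X B P + (𝟙 (X a b) + 𝟙 (X b a))                  ∎
  where
  open ≡-Reasoning
  P′ = removePair a b P
  gain : PairMat _ → Fin _ → Fin _ → ℕ
  gain Q i j = 𝟙 (X i j ∧ (⟦ B ⟧ i j ∧ not (⟦ Q ⟧ i j)))
  ba∈P : T (⟦ P ⟧ b a)
  ba∈P = subst T (⟦⟧-sym P a b) ab∈P
  ba∉P′ : ⟦ P′ ⟧ b a ≡ false
  ba∉P′ = trans (⟦⟧-sym P′ b a) (removePair-removed a b P)
  still : ∀ i j → T (⟦ P ⟧ i j) → gain P i j ≡ 0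
  still i j ij∈P rewrite Equivalence.to T-≡ ij∈P | ∧-zeroʳ (⟦ B ⟧ i j) | ∧-zeroʳ (X i j) = refl
  now : ∀ i j → ⟦ P′ ⟧ i j ≡ false → T (⟦ P ⟧ i j) → gain P′ i j ≡ 𝟙 (X i j)
  now i j ij∉P′ ij∈P rewrite ij∉P′ | Equivalence.to T-≡ (P⊆B i j ij∈P) | ∧-identityʳ (X i j) = refl
  unchanged : ∀ i j → (i ≡ a → j ≢ b) → (i ≡ b → j ≢ a) → gain P i j ≡ gain P′ i j
  unchanged i j ¬ab ¬ba = cong (λ t → 𝟙 (X i j ∧ (⟦ B ⟧ i j ∧ not t))) (sym (removePair-elsewhere a b P ¬ab ¬ba))

module _ {n : ℕ} (s : Fin n → Fin n) (H : PairMat n) where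

  steps-⊆ : {P Q : PairMat n} → Star (Step s H) P Q → Q ⊆ P
  steps-⊆ ε i j ij∈Q = ij∈Q
  steps-⊆ {P} (step u₁ u₂ u₃ u₃′ _ _ _ _ _ _ _ ◅ rest) i j ij∈Q =
    removePair-⊆ u₁ u₃ P i j (removePair-⊆ u₂ u₃′ (removePair u₁ u₃ P) i j (steps-⊆ rest i j ij∈Q))

  removePair-inside : {a b i j : Fin n} (P : PairMat n) → s a ≢ s b → s i ≡ s j → ⟦ removePair a b P ⟧ i j ≡ ⟦ P ⟧ i j
  removePair-inside P sa≢sb si≡sj =
    removePair-elsewhere _ _ P (λ { refl refl → sa≢sb si≡sj }) (λ { refl refl → sa≢sb (sym si≡sj) })

  steps-inside : {P Q : PairMat n} → Star (Step s H) P Q → ∀ {i j} → s i ≡ s j → ⟦ Q ⟧ i j ≡ ⟦ P ⟧ i j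
  steps-inside ε _ = refl
  steps-inside {P} {Q} (step u₁ u₂ u₃ u₃′ _ s₁≢s₃ s₂≢s₃ _ s₃′≡s₃ _ _ ◅ rest) {i} {j} si≡sj = begin
    ⟦ Q ⟧ i j                                           ≡⟨ steps-inside rest si≡sj ⟩
    ⟦ removePair u₂ u₃′ (removePair u₁ u₃ P) ⟧ i j      ≡⟨ removePair-inside (removePair u₁ u₃ P) (λ e → s₂≢s₃ (trans e s₃′≡s₃)) si≡sj ⟩
    ⟦ removePair u₁ u₃ P ⟧ i j                          ≡⟨ removePair-inside P s₁≢s₃ si≡sj ⟩
    ⟦ P ⟧ i j                                           ∎
    where open ≡-Reasoning

  StepCharge : (X Y : Fin n → Fin n → Bool) → Set
  StepCharge X Y = ∀ u₁ u₂ u₃ u₃′ → s u₁ ≢ s u₂ → s u₁ ≢ s u₃ → s u₂ ≢ s u₃ → T (hostile s H (s u₁) (s u₂)) →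
    s u₃′ ≡ s u₃ → 𝟙 (X u₁ u₃) + 𝟙 (X u₂ u₃′) ≤ 𝟙 (Y u₁ u₃) + 𝟙 (Y u₂ u₃′)

  step-charge : {X Y : Fin n → Fin n → Bool} → (∀ i j → X i j ≡ X j i) → (∀ i j → Y i j ≡ Y j i) →
    StepCharge X Y → {B P P′ : PairMat n} → Step s H P P′ → P ⊆ B →
    removed X B P ≤ removed Y B P → removed X B P′ ≤ removed Y B P′
  step-charge {X} {Y} X-sym Y-sym charge {B} {P} (step u₁ u₂ u₃ u₃′ s₁≢s₂ s₁≢s₃ s₂≢s₃ hostile₁₂ s₃′≡s₃ 13∈P 23∈P) P⊆B le =
    subst₂ _≤_ (sym (counted X)) (sym (counted Y)) (+-mono-≤ le (doubled (charge u₁ u₂ u₃ u₃′ s₁≢s₂ s₁≢s₃ s₂≢s₃ hostile₁₂ s₃′≡s₃)))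
    where
    P₁ = removePair u₁ u₃ P
    gain : (Fin n → Fin n → Bool) → Fin n → Fin n → ℕ
    gain Z a b = 𝟙 (Z a b) + 𝟙 (Z b a)
    23∈P₁ : T (⟦ P₁ ⟧ u₂ u₃′)
    23∈P₁ = subst T (sym (removePair-elsewhere u₁ u₃ P (λ e _ → s₁≢s₂ (cong s (sym e))) (λ e _ → s₂≢s₃ (cong s e)))) 23∈P
    counted : ∀ Z → removed Z B (removePair u₂ u₃′ P₁) ≡ removed Z B P + (gain Z u₁ u₃ + gain Z u₂ u₃′)
    counted Z = begin
      removed Z B (removePair u₂ u₃′ P₁)                   ≡⟨ removed-removePair Z {B} u₂ u₃′ (λ i j → P⊆B i j ∘ removePair-⊆ u₁ u₃ P i j)
                                                                                 (λ e → s₂≢s₃ (trans (cong s e) s₃′≡s₃)) 23∈P₁ ⟩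
      removed Z B P₁ + gain Z u₂ u₃′                       ≡⟨ cong (_+ gain Z u₂ u₃′) (removed-removePair Z {B} u₁ u₃ P⊆B (λ e → s₁≢s₃ (cong s e)) 13∈P) ⟩
      removed Z B P + gain Z u₁ u₃ + gain Z u₂ u₃′         ≡⟨ +-assoc (removed Z B P) _ _ ⟩
      removed Z B P + (gain Z u₁ u₃ + gain Z u₂ u₃′)       ∎
      where open ≡-Reasoning
    doubled : 𝟙 (X u₁ u₃) + 𝟙 (X u₂ u₃′) ≤ 𝟙 (Y u₁ u₃) + 𝟙 (Y u₂ u₃′) →
              gain X u₁ u₃ + gain X u₂ u₃′ ≤ gain Y u₁ u₃ + gain Y u₂ u₃′
    doubled le₁ = subst₂ _≤_ (twice X X-sym) (twice Y Y-sym) (+-mono-≤ le₁ le₁)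
      where
      interchange : ∀ a b → (a + b) + (a + b) ≡ (a + a) + (b + b)
      interchange = solve-∀
      twice : ∀ Z → (∀ i j → Z i j ≡ Z j i) → (𝟙 (Z u₁ u₃) + 𝟙 (Z u₂ u₃′)) + (𝟙 (Z u₁ u₃) + 𝟙 (Z u₂ u₃′)) ≡ gain Z u₁ u₃ + gain Z u₂ u₃′
      twice Z Z-sym = trans (interchange (𝟙 (Z u₁ u₃)) (𝟙 (Z u₂ u₃′)))
                            (cong₂ _+_ (cong (𝟙 (Z u₁ u₃) +_) (cong 𝟙 (Z-sym u₁ u₃))) (cong (𝟙 (Z u₂ u₃′) +_) (cong 𝟙 (Z-sym u₂ u₃′))))

  steps-charge : {X Y : Fin n → Fin n → Bool} → (∀ i j → X i j ≡ X j i) → (∀ i j → Y i j ≡ Y j i) →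
    StepCharge X Y → {B Q : PairMat n} → Star (Step s H) B Q → removed X B Q ≤ removed Y B Q
  steps-charge {X} {Y} X-sym Y-sym charge {B} run = from run (λ _ _ ij∈B → ij∈B) (≤-reflexive (trans (nothing-removed X) (sym (nothing-removed Y))))
    where
    nothing-removed : ∀ Z → removed Z B B ≡ 0
    nothing-removed Z = trans (∑∑-cong λ i j → cong 𝟙 (trans (cong (Z i j ∧_) (∧-inverseʳ (⟦ B ⟧ i j))) (∧-zeroʳ (Z i j)))) (∑∑-zero {n})
    from : ∀ {P Q} → Star (Step s H) P Q → P ⊆ B → removed X B P ≤ removed Y B P → removed X B Q ≤ removed Y B Q
    from ε _ le = le
    from (st ◅ rest) P⊆B le =
      from rest (λ i j → P⊆B i j ∘ steps-⊆ (st ◅ ε) i j) (step-charge X-sym Y-sym charge {B} st P⊆B le)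

-- The analysis of Transform

module _ {n : ℕ} (s : Fin n → Fin n) where

  hostile-sym : (H : PairMat n) (U W : Fin n) → hostile s H U W ≡ hostile s H W U
  hostile-sym H U W = T-ext (flipped U W) (flipped W U)
    where
    flipped : ∀ U W → T (hostile s H U W) → T (hostile s H W U)
    flipped U W h with anyInBlock⁻ s ⟦ H ⟧ h
    ... | a , b , refl , refl , ab∈H = anyInBlock⁺ s ⟦ H ⟧ (subst T (⟦⟧-sym H a b) ab∈H)

  E₁-across : (E : PairMat n) {u v : Fin n} → s u ≢ s v → E₁ s E u v ≡ ⟦ E ⟧ u v
  E₁-across E {u} {v} su≢sv rewrite ≢⇒==ᵇ su≢sv = trans (cong (⟦ E ⟧ u v ∨_) (∧-zeroʳ (u ≠ᵇ v))) (∨-identityʳ _)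

  E₁-inside : (E : PairMat n) {u v : Fin n} → s u ≡ s v → E₁ s E u v ≡ (u ≠ᵇ v)
  E₁-inside E {u} {v} su≡sv rewrite ≡⇒==ᵇ su≡sv | ∧-identityʳ (u ≠ᵇ v) =
    trans (∨-comm (⟦ E ⟧ u v) (u ≠ᵇ v)) (∨-abs-∧ (u ≠ᵇ v) (E u v ∨ E v u))

  ⟦E₂⟧≡E₂ : (E H : PairMat n) (u v : Fin n) → ⟦ E₂ s E H ⟧ u v ≡ E₂ s E H u v
  ⟦E₂⟧≡E₂ E H = ⟦⟧-of-symmetric (E₂ s E H) E₂-sym E₂-irrefl
    where
    E₂-sym : ∀ u v → E₂ s E H u v ≡ E₂ s E H v u
    E₂-sym u v = cong₂ _∧_ (cong₂ _∨_ (⟦⟧-sym E u v) (cong₂ _∧_ (cong not (==ᵇ-sym u v)) (==ᵇ-sym (s u) (s v))))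
                           (cong not (hostile-sym H (s u) (s v)))
    E₂-irrefl : ∀ u → E₂ s E H u u ≡ false
    E₂-irrefl u rewrite ==ᵇ-refl u = refl

module Instance {n : ℕ} (E F H : PairMat n) (s : Fin n → Fin n) (supernodes : IsSupernodeLabelling F s)
                (opt : Clustering n) (optimal : OptimalValid E F H opt) where

  opt-on-supernodes : {a b : Fin n} → s a ≡ s b → opt a ≡ opt b
  opt-on-supernodes {a} {b} sa≡sb = along (Equivalence.to (supernodes a b) sa≡sb)
    where
    along : ∀ {a b} → Star (λ x y → T (⟦ F ⟧ x y)) a b → opt a ≡ opt b
    along ε = refl
    along (ab∈F ◅ path) = trans (proj₁ (proj₁ optimal) _ _ ab∈F) (along path)

  hostile⇒split : {U W a b : Fin n} → T (hostile s H U W) → s a ≡ U → s b ≡ W → opt a ≢ opt b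
  hostile⇒split h sa≡U sb≡W opta≡optb with anyInBlock⁻ s ⟦ H ⟧ h
  ... | a′ , b′ , refl , refl , a′b′∈H = proj₂ (proj₁ optimal) a′ b′ a′b′∈H
    (trans (opt-on-supernodes (sym sa≡U)) (trans opta≡optb (opt-on-supernodes sb≡W)))

  not-self-hostile : (a : Fin n) → hostile s H (s a) (s a) ≡ false
  not-self-hostile a with hostile s H (s a) (s a) in h
  ... | false = refl
  ... | true  = ⊥-elim (hostile⇒split {a = a} {b = a} (subst T (sym h) _) refl refl refl)

  joined : Fin n → Fin n → Bool
  joined = anyInBlock s λ a b → opt a ==ᵇ opt b

  joined-at : (a b : Fin n) → (opt a ==ᵇ opt b) ≡ joined (s a) (s b)
  joined-at a b = T-ext (anyInBlock⁺ s (λ a b → opt a ==ᵇ opt b)) from-block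
    where
    from-block : T (joined (s a) (s b)) → T (opt a ==ᵇ opt b)
    from-block h with anyInBlock⁻ s (λ a b → opt a ==ᵇ opt b) h
    ... | a′ , b′ , sa′≡sa , sb′≡sb , a′~b′ = subst T (sym (≡⇒==ᵇ
      (trans (opt-on-supernodes (sym sa′≡sa)) (trans (==ᵇ⇒≡ (Equivalence.to T-≡ a′~b′)) (opt-on-supernodes sb′≡sb))))) _

  joined-sym : (U W : Fin n) → joined U W ≡ joined W U
  joined-sym U W = T-ext (flipped U W) (flipped W U)
    where
    flipped : ∀ U W → T (joined U W) → T (joined W U)
    flipped U W h with anyInBlock⁻ s (λ a b → opt a ==ᵇ opt b) h
    ... | a , b , refl , refl , a~b = anyInBlock⁺ s (λ a b → opt a ==ᵇ opt b) (subst T (==ᵇ-sym (opt a) (opt b)) a~b)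

  joined⇒friendly : (a b : Fin n) → joined (s a) (s b) ≡ true → hostile s H (s a) (s b) ≡ false
  joined⇒friendly a b j with hostile s H (s a) (s b) in h
  ... | false = refl
  ... | true  = ⊥-elim (hostile⇒split (subst T (sym h) _) refl refl (==ᵇ⇒≡ (trans (joined-at a b) j)))

  E₂-inside : {a b : Fin n} → s a ≡ s b → ⟦ E₂ s E H ⟧ a b ≡ (a ≠ᵇ b)
  E₂-inside {a} {b} sa≡sb rewrite ⟦E₂⟧≡E₂ s E H a b | E₁-inside s E sa≡sb | sa≡sb | not-self-hostile b =
    ∧-identityʳ (a ≠ᵇ b)

  E₂-across : {a b : Fin n} → s a ≢ s b → ⟦ E₂ s E H ⟧ a b ≡ ⟦ E ⟧ a b ∧ not (hostile s H (s a) (s b))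
  E₂-across {a} {b} sa≢sb rewrite ⟦E₂⟧≡E₂ s E H a b | E₁-across s E sa≢sb = refl

  E₂-across-⊆ : {a b : Fin n} → s a ≢ s b → T (⟦ E₂ s E H ⟧ a b) → T (⟦ E ⟧ a b)
  E₂-across-⊆ sa≢sb h = proj₁ (Equivalence.to T-∧ (subst T (E₂-across sa≢sb) h))

  E₂-across-joined : {a b : Fin n} → s a ≢ s b → joined (s a) (s b) ≡ true → ⟦ E₂ s E H ⟧ a b ≡ ⟦ E ⟧ a b
  E₂-across-joined {a} {b} sa≢sb j rewrite E₂-across sa≢sb | joined⇒friendly a b j = ∧-identityʳ (⟦ E ⟧ a b)

  module Run (E₃ : PairMat n) (run : Star (Step s H) (E₂ s E H) E₃) (done : Terminal s H E₃) where

    -- A kind of block (U, W) is a predicate of three bits: U ≢ W, OPT joins U and W,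
    -- and E₃ has no pair between U and W.
    Kind : Set
    Kind = Bool → Bool → Bool → Bool

    J S J₀ J₁ S₀ S₊ : Kind
    J  apart j z = apart ∧ j
    S  apart j z = apart ∧ not j
    J₀ apart j z = apart ∧ (j ∧ z)
    J₁ apart j z = apart ∧ (j ∧ not z)
    S₀ apart j z = apart ∧ (not j ∧ z)
    S₊ apart j z = apart ∧ (not j ∧ not z)

    empty : Fin n → Fin n → Bool
    empty U W = crossCount s E₃ U W ≡ᵇ 0

    onBlocks : Kind → Fin n → Fin n → Bool
    onBlocks κ U W = κ (not (U ==ᵇ W)) (joined U W) (empty U W)

    onPairs : Kind → Fin n → Fin n → Bool
    onPairs κ a b = onBlocks κ (s a) (s b)

    onPairs-sym : (κ : Kind) (a b : Fin n) → onPairs κ a b ≡ onPairs κ b a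
    onPairs-sym κ a b = trans (cong₂ (λ x y → κ x y (empty (s a) (s b))) (cong not (==ᵇ-sym (s a) (s b))) (joined-sym (s a) (s b)))
                              (cong (κ _ _) (cong (_≡ᵇ 0) (crossCount-sym s E₃ (s a) (s b))))

    not-both-joined : (u₁ u₂ u₃ u₃′ : Fin n) → T (hostile s H (s u₁) (s u₂)) → s u₃′ ≡ s u₃ →
                      joined (s u₁) (s u₃) ∧ joined (s u₂) (s u₃′) ≡ false
    not-both-joined u₁ u₂ u₃ u₃′ hostile₁₂ s₃′≡s₃ with joined (s u₁) (s u₃) in j₁ | joined (s u₂) (s u₃′) in j₂
    ... | false | _     = refl
    ... | true  | false = refl
    ... | true  | true  = ⊥-elim (hostile⇒split hostile₁₂ refl refl
      (trans (==ᵇ⇒≡ (trans (joined-at u₁ u₃) j₁)) (trans (opt-on-supernodes (sym s₃′≡s₃)) (sym (==ᵇ⇒≡ (trans (joined-at u₂ u₃′) j₂))))))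

    nonempty-witness : {U W : Fin n} → empty U W ≡ false → ∃₂ λ a b → s a ≡ U × s b ≡ W × T (⟦ E₃ ⟧ a b)
    nonempty-witness {U} {W} z = blockCount-nonzero s ⟦ E₃ ⟧ U W λ count≡0 →
      contradiction (trans (sym (cong (_≡ᵇ 0) (trans (crossCount≡blockCount s E₃ U W) count≡0))) z) (λ ())

    -- This is where termination of the loop is used.
    some-empty : (u₁ u₂ u₃ u₃′ : Fin n) → s u₁ ≢ s u₂ → s u₁ ≢ s u₃ → s u₂ ≢ s u₃ →
                 T (hostile s H (s u₁) (s u₂)) → s u₃′ ≡ s u₃ → empty (s u₁) (s u₃) ∨ empty (s u₂) (s u₃′) ≡ true
    some-empty u₁ u₂ u₃ u₃′ s₁≢s₂ s₁≢s₃ s₂≢s₃ hostile₁₂ s₃′≡s₃ with empty (s u₁) (s u₃) in z₁ | empty (s u₂) (s u₃′) in z₂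
    ... | true  | _     = refl
    ... | false | true  = refl
    ... | false | false with nonempty-witness z₁ | nonempty-witness z₂
    ...   | a , b , sa , sb , ab∈E₃ | c , d , sc , sd , cd∈E₃ =
      ⊥-elim (done a c b d (λ e → s₁≢s₂ (trans (sym sa) (trans e sc))) (λ e → s₁≢s₃ (trans (sym sa) (trans e sb)))
                   (λ e → s₂≢s₃ (trans (sym sc) (trans e sb))) (subst₂ (λ U W → T (hostile s H U W)) (sym sa) (sym sc) hostile₁₂)
                   (trans sd (trans s₃′≡s₃ (sym sb))) ab∈E₃ cd∈E₃)

    kind-charge : (φ ψ : Kind) →
      (∀ j₁ z₁ j₂ z₂ → j₁ ∧ j₂ ≡ false → z₁ ∨ z₂ ≡ true →
         𝟙 (φ true j₁ z₁) + 𝟙 (φ true j₂ z₂) ≤ 𝟙 (ψ true j₁ z₁) + 𝟙 (ψ true j₂ z₂)) →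
      StepCharge s H (onPairs φ) (onPairs ψ)
    kind-charge φ ψ table u₁ u₂ u₃ u₃′ s₁≢s₂ s₁≢s₃ s₂≢s₃ hostile₁₂ s₃′≡s₃
      rewrite ≢⇒==ᵇ s₁≢s₃ | ≢⇒==ᵇ (λ e → s₂≢s₃ (trans e s₃′≡s₃)) =
      table _ _ _ _ (not-both-joined u₁ u₂ u₃ u₃′ hostile₁₂ s₃′≡s₃) (some-empty u₁ u₂ u₃ u₃′ s₁≢s₂ s₁≢s₃ s₂≢s₃ hostile₁₂ s₃′≡s₃)

    J-by-S : ∀ j₁ z₁ j₂ z₂ → j₁ ∧ j₂ ≡ false → z₁ ∨ z₂ ≡ true →
             𝟙 (J true j₁ z₁) + 𝟙 (J true j₂ z₂) ≤ 𝟙 (S true j₁ z₁) + 𝟙 (S true j₂ z₂)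
    J-by-S true  _ true  _ () _
    J-by-S true  _ false _ _  _ = ≤-refl
    J-by-S false _ true  _ _  _ = ≤-refl
    J-by-S false _ false _ _  _ = z≤n

    J₁-by-S₀ : ∀ j₁ z₁ j₂ z₂ → j₁ ∧ j₂ ≡ false → z₁ ∨ z₂ ≡ true →
               𝟙 (J₁ true j₁ z₁) + 𝟙 (J₁ true j₂ z₂) ≤ 𝟙 (S₀ true j₁ z₁) + 𝟙 (S₀ true j₂ z₂)
    J₁-by-S₀ true  _     true  _     () _
    J₁-by-S₀ true  true  false _     _  _ = z≤n
    J₁-by-S₀ true  false false true  _  _ = ≤-refl
    J₁-by-S₀ true  false false false _  ()
    J₁-by-S₀ false _     true  true  _  _ = z≤n
    J₁-by-S₀ false true  true  false _  _ = ≤-refl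
    J₁-by-S₀ false false true  false _  ()
    J₁-by-S₀ false _     false _     _  _ = z≤n

    E₃⊆E₂ : E₃ ⊆ E₂ s E H
    E₃⊆E₂ = steps-⊆ s H run

    threshold : Fin n → Fin n → Bool
    threshold U W = exceedsThreshold (crossCount s E₃ U W) (crossSize s U W)

    E₄-across : {U W a b : Fin n} → U ≢ W → s a ≡ U → s b ≡ W → ⟦ E₄ s E₃ ⟧ a b ≡ threshold U W
    E₄-across {a = a} {b} U≢W refl refl =
      trans (⟦⟧-both (E₄ s E₃) E₄-ab E₄-ba) (cong (λ t → not t ∧ threshold (s a) (s b)) (≢⇒==ᵇ (U≢W ∘ cong s)))
      where
      E₄-ab : E₄ s E₃ a b ≡ threshold (s a) (s b)
      E₄-ab rewrite ≢⇒==ᵇ U≢W = refl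
      E₄-ba : E₄ s E₃ b a ≡ threshold (s a) (s b)
      E₄-ba rewrite ≢⇒==ᵇ (U≢W ∘ sym) = cong₂ exceedsThreshold (crossCount-sym s E₃ (s b) (s a)) (crossSize-sym s (s b) (s a))

    E₄-inside : {a b : Fin n} → s a ≡ s b → ⟦ E₄ s E₃ ⟧ a b ≡ (a ≠ᵇ b)
    E₄-inside {a} {b} sa≡sb = trans (⟦⟧-both (E₄ s E₃) (inside a b sa≡sb) (trans (inside b a (sym sa≡sb)) (cong not (==ᵇ-sym b a))))
                                    (∧-idem (a ≠ᵇ b))
      where
      inside : ∀ a b → s a ≡ s b → E₄ s E₃ a b ≡ (a ≠ᵇ b)
      inside a b sa≡sb rewrite ≡⇒==ᵇ sa≡sb = trans (steps-inside s H run sa≡sb) (E₂-inside sa≡sb)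

    opt-across : {U W a b : Fin n} → U ≢ W → s a ≡ U → s b ≡ W → ⟦ clusterEdges opt ⟧ a b ≡ joined U W
    opt-across {a = a} {b} U≢W refl refl =
      trans (⟦⟧-both (clusterEdges opt) (joined-at a b) (trans (joined-at b a) (joined-sym (s b) (s a))))
            (cong (λ t → not t ∧ joined (s a) (s b)) (≢⇒==ᵇ (U≢W ∘ cong s)))

    opt-inside : {a b : Fin n} → s a ≡ s b → ⟦ clusterEdges opt ⟧ a b ≡ (a ≠ᵇ b)
    opt-inside {a} {b} sa≡sb = trans (⟦⟧-both (clusterEdges opt) (≡⇒==ᵇ opta≡optb) (≡⇒==ᵇ (sym opta≡optb))) (∧-identityʳ (a ≠ᵇ b))
      where
      opta≡optb = opt-on-supernodes sa≡sb

    m e e₂ k r c₄ cₒ : Fin n → Fin n → ℕ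
    m  = crossSize s
    e  = blockCount s ⟦ E ⟧
    e₂ = blockCount s ⟦ E₂ s E H ⟧
    k  = crossCount s E₃
    r U W = e₂ U W ∸ k U W
    c₄ = blockCount s λ a b → ⟦ E ⟧ a b xor ⟦ E₄ s E₃ ⟧ a b
    cₒ = blockCount s λ a b → ⟦ E ⟧ a b xor ⟦ clusterEdges opt ⟧ a b

    k≤e₂ : (U W : Fin n) → k U W ≤ e₂ U W
    k≤e₂ U W = subst (_≤ e₂ U W) (sym (crossCount≡blockCount s E₃ U W)) (blockCount-mono s λ a b _ _ → E₃⊆E₂ a b)

    e₂≤e : {U W : Fin n} → U ≢ W → e₂ U W ≤ e U W
    e₂≤e U≢W = blockCount-mono s λ { a b refl refl → E₂-across-⊆ U≢W }

    e≤m : (U W : Fin n) → e U W ≤ m U W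
    e≤m U W = subst (e U W ≤_) (sym (crossSize≡blockSize s U W)) (blockCount≤blockSize s ⟦ E ⟧ U W)

    joined⇒e₂≡e : {U W : Fin n} → U ≢ W → joined U W ≡ true → e₂ U W ≡ e U W
    joined⇒e₂≡e U≢W j = blockCount-cong s λ { a b refl refl → E₂-across-joined U≢W j }

    c₄-across : {U W : Fin n} → U ≢ W → c₄ U W ≡ (if threshold U W then m U W ∸ e U W else e U W)
    c₄-across {U} {W} U≢W = trans (blockCount-xor s ⟦ E ⟧ ⟦ E₄ s E₃ ⟧ U W (threshold U W) λ a b → E₄-across U≢W)
      (cong (λ size → if threshold U W then size ∸ e U W else e U W) (sym (crossSize≡blockSize s U W)))

    cₒ-across : {U W : Fin n} → U ≢ W → cₒ U W ≡ (if joined U W then m U W ∸ e U W else e U W)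
    cₒ-across {U} {W} U≢W = trans (blockCount-xor s ⟦ E ⟧ ⟦ clusterEdges opt ⟧ U W (joined U W) λ a b → opt-across U≢W)
      (cong (λ size → if joined U W then size ∸ e U W else e U W) (sym (crossSize≡blockSize s U W)))

    c₄≡cₒ-inside : (U : Fin n) → c₄ U U ≡ cₒ U U
    c₄≡cₒ-inside U = blockCount-cong s λ a b sa≡U sb≡U → cong (⟦ E ⟧ a b xor_)
      (trans (E₄-inside (trans sa≡U (sym sb≡U))) (sym (opt-inside (trans sa≡U (sym sb≡U)))))

    block-inequality : (U W : Fin n) →
      c₄ U W + when (onBlocks S₊ U W) (r U W) ≤ cₒ U W + when (onBlocks J₀ U W) (r U W)
        +√5· (when (onBlocks J₁ U W) (cₒ U W + r U W) + when (onBlocks S₊ U W) (cₒ U W))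
    block-inequality U W with U ≟ W
    ... | yes refl = ≤⇒≤+√5· (≤-reflexive (cong (_+ 0) (c₄≡cₒ-inside U)))
    ... | no U≢W rewrite c₄-across U≢W | cₒ-across U≢W =
      block-bound (joined U W) (k≤e₂ U W) (e₂≤e U≢W) (e≤m U W) (joined⇒e₂≡e U≢W)

    removed-in-block : (U W : Fin n) → blockCount s (λ a b → ⟦ E₂ s E H ⟧ a b ∧ not (⟦ E₃ ⟧ a b)) U W ≡ r U W
    removed-in-block U W = sym (begin
      e₂ U W ∸ k U W                                  ≡⟨ cong₂ _∸_ (blockCount-split s ⟦ E₂ s E H ⟧ ⟦ E₃ ⟧ U W) (crossCount≡blockCount s E₃ U W) ⟩
      blockCount s (λ a b → ⟦ E₂ s E H ⟧ a b ∧ ⟦ E₃ ⟧ a b) U W + gone ∸ blockCount s ⟦ E₃ ⟧ U W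
                                                      ≡⟨ cong (λ t → t + gone ∸ blockCount s ⟦ E₃ ⟧ U W) (blockCount-cong s λ a b _ _ → kept a b) ⟩
      blockCount s ⟦ E₃ ⟧ U W + gone ∸ blockCount s ⟦ E₃ ⟧ U W  ≡⟨ m+n∸m≡n (blockCount s ⟦ E₃ ⟧ U W) gone ⟩
      gone                                            ∎)
      where
      open ≡-Reasoning
      gone = blockCount s (λ a b → ⟦ E₂ s E H ⟧ a b ∧ not (⟦ E₃ ⟧ a b)) U W
      kept : ∀ a b → ⟦ E₂ s E H ⟧ a b ∧ ⟦ E₃ ⟧ a b ≡ ⟦ E₃ ⟧ a b
      kept a b with ⟦ E₃ ⟧ a b in ab∈E₃
      ... | false = ∧-zeroʳ _
      ... | true  = trans (∧-identityʳ _) (Equivalence.to T-≡ (E₃⊆E₂ a b (subst T (sym ab∈E₃) _)))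

    removed-kind : (κ : Kind) → removed (onPairs κ) (E₂ s E H) E₃ ≡ ∑∑ λ U W → when (onBlocks κ U W) (r U W)
    removed-kind κ = trans (∑∑-blockCount s _) (∑∑-cong λ U W → begin
      blockCount s (λ a b → onPairs κ a b ∧ (⟦ E₂ s E H ⟧ a b ∧ not (⟦ E₃ ⟧ a b))) U W
        ≡⟨ blockCount-cong s (λ { a b refl refl → refl }) ⟩
      blockCount s (λ a b → onBlocks κ U W ∧ (⟦ E₂ s E H ⟧ a b ∧ not (⟦ E₃ ⟧ a b))) U W
        ≡⟨ blockCount-guard s (onBlocks κ U W) _ U W ⟩
      when (onBlocks κ U W) (blockCount s (λ a b → ⟦ E₂ s E H ⟧ a b ∧ not (⟦ E₃ ⟧ a b)) U W)
        ≡⟨ cong (when (onBlocks κ U W)) (removed-in-block U W) ⟩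
      when (onBlocks κ U W) (r U W)  ∎)
      where open ≡-Reasoning

    R : Kind → ℕ
    R κ = ∑∑ λ U W → when (onBlocks κ U W) (r U W)

    w : Fin n → Fin n → ℕ
    w U W = when (onBlocks J₁ U W) (cₒ U W + r U W) + when (onBlocks S₊ U W) (cₒ U W)

    summed : ∑∑ c₄ + R S₊ ≤ ∑∑ cₒ + R J₀ +√5· ∑∑ w
    summed = subst₂ (λ x y → x ≤ y +√5· ∑∑ w) (∑∑-distrib-+ c₄ _) (∑∑-distrib-+ cₒ _) (≤+√5·-∑∑ block-inequality)

    charged : (φ ψ : Kind) → StepCharge s H (onPairs φ) (onPairs ψ) → R φ ≤ R ψ
    charged φ ψ charge = subst₂ _≤_ (removed-kind φ) (removed-kind ψ) (steps-charge s H (onPairs-sym φ) (onPairs-sym ψ) charge run)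

    J-charged : R J₁ + R J₀ ≤ R S₀ + R S₊
    J-charged = subst₂ _≤_ (split-R J J₁ J₀ J-split) (split-R S S₀ S₊ S-split) (charged J S (kind-charge J S J-by-S))
      where
      split-R : ∀ κ κ₁ κ₂ → (∀ a j z ρ → when (κ a j z) ρ ≡ when (κ₁ a j z) ρ + when (κ₂ a j z) ρ) → R κ ≡ R κ₁ + R κ₂
      split-R κ κ₁ κ₂ split = trans (∑∑-cong λ U W → split _ _ _ (r U W)) (∑∑-distrib-+ (λ U W → when (onBlocks κ₁ U W) (r U W)) _)
      J-split : ∀ a j z ρ → when (J a j z) ρ ≡ when (J₁ a j z) ρ + when (J₀ a j z) ρ
      J-split false _     _     _ = refl
      J-split true  false _     _ = refl
      J-split true  true  false ρ = sym (+-identityʳ ρ)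
      J-split true  true  true  ρ = refl
      S-split : ∀ a j z ρ → when (S a j z) ρ ≡ when (S₀ a j z) ρ + when (S₊ a j z) ρ
      S-split false _     _     _ = refl
      S-split true  true  _     _ = refl
      S-split true  false false ρ = refl
      S-split true  false true  ρ = sym (+-identityʳ ρ)

    J₁-charged : R J₁ ≤ R S₀
    J₁-charged = charged J₁ S₀ (kind-charge J₁ S₀ J₁-by-S₀)

    absorbed : ∑∑ w + R S₀ ≤ ∑∑ cₒ + R J₁
    absorbed = subst₂ _≤_ (∑∑-distrib-+ w _) (∑∑-distrib-+ cₒ _) (∑∑-mono-≤ in-block)
      where
      kinds-bound : ∀ j z (c ρ : ℕ) → (j ≡ false → z ≡ true → ρ ≤ c) →
        when (J₁ true j z) (c + ρ) + when (S₊ true j z) c + when (S₀ true j z) ρ ≤ c + when (J₁ true j z) ρ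
      kinds-bound true  true  c ρ _ = z≤n
      kinds-bound true  false c ρ _ = ≤-reflexive (trans (+-identityʳ _) (+-identityʳ _))
      kinds-bound false true  c ρ ρ≤c = ≤-trans (ρ≤c refl refl) (≤-reflexive (sym (+-identityʳ c)))
      kinds-bound false false c ρ _ = ≤-refl
      in-block : ∀ U W → w U W + when (onBlocks S₀ U W) (r U W) ≤ cₒ U W + when (onBlocks J₁ U W) (r U W)
      in-block U W with U ≟ W
      ... | yes refl = z≤n
      ... | no U≢W = kinds-bound (joined U W) (empty U W) (cₒ U W) (r U W) λ j≡false _ →
        ≤-trans (m∸n≤m (e₂ U W) (k U W)) (≤-trans (e₂≤e U≢W) (≤-reflexive (sym (trans (cₒ-across U≢W) (cong (λ j → if j then _ else e U W) j≡false)))))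

    symDiff≡blocks : (P : PairMat n) → 2 * symDiff E P ≡ ∑∑ (blockCount s λ a b → ⟦ E ⟧ a b xor ⟦ P ⟧ a b)
    symDiff≡blocks P = trans (symDiff≡∑∑ E P) (∑∑-blockCount s _)

lemma12 : ∀ {n} (E F H : PairMat n) (s : Fin n → Fin n) →
          IsSupernodeLabelling F s →
          (opt : Clustering n) → OptimalValid E F H opt →
          (E₃ : PairMat n) → Star (Step s H) (E₂ s E H) E₃ → Terminal s H E₃ →
          ≤OnePlusSqrt5* (symDiff E (E₄ s E₃)) (symDiff E (clusterEdges opt))
lemma12 E F H s supernodes opt optimal E₃ run done =
  ≤+√5·⇒≤OnePlusSqrt5* {symDiff E (E₄ s E₃)} {symDiff E (clusterEdges opt)}
    (subst₂ (λ x y → x ≤ y +√5· y) (sym (symDiff≡blocks (E₄ s E₃))) (sym (symDiff≡blocks (clusterEdges opt)))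
      (≤+√5·-discharge summed J-charged J₁-charged absorbed))
  where
  open Instance E F H s supernodes opt optimal
  open Run E₃ run done
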